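{- Let $\mu,\nu$ be compositions with $n=\lvert\mu\rvert+\lvert\nu\rvert$, let $\kappa$ be a sorted recurrent configuration of $\widehat G_{\mu,\nu}$, and let $\sigma\in\mathfrak S_n$ be the output word of the toppling algorithm applied to $\kappa$. Then for every $i\in[n]$, $0\le u_{\sigma^{ -1}(i)}<w_{\sigma^{ -1}(i)}(\sigma)$.
   Context: The graph $\widehat G_{\mu,\nu}$: vertex set $[n]$ partitioned into clique components $K_{\mu_1}=\{n,\dots,n-\mu_1+1\}$, $K_{\mu_2}=\{n-\mu_1,\dots,n-\mu_1-\mu_2+1\}$, etc., and independent components $I_{\nu_1}=\{1,\dots,\nu_1\}$, $I_{\nu_2}=\{\nu_1+1,\dots,\nu_1+\nu_2\}$, etc.; distinct vertices are adjacent iff they lie in different components or in the same clique component; plus a sink $0$ adjacent to all of $[n]$. Sandpile model: configurations are maps $\kappa:[n]\to\mathbb Z$; a non-sink vertex $v$ is stable if $\kappa(v)<\deg(v)$, unstable otherwise; toppling $v$ subtracts $\deg(v)$ at $v$ and adds $1$ at each neighbour. A stable $\kappa$ is recurrent if for some ordering of $[n]$, after toppling the sink and then the vertices of $[n]$ in this order, all intermediate configurations are non-negative on $[n]$. Sorted: weakly decreasing on each clique component and weakly increasing on each independent component (with respect to the integer order of the vertices). Toppling algorithm for a recurrent $\kappa$: topple the sink; then while some non-sink vertex is untoppled, for $i=n,\dots,1$: if $i$ is unstable, topple it and append $i$ to the output word. The output $\sigma=\sigma(1)\cdots\sigma(n)$ is a permutation in one-line notation; $\sigma^{ -1}(i)$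 is the position of $i$. Define $\widetilde\kappa$ by $\widetilde\kappa(v)=\kappa(v)$ on clique components and, listing $I_{\nu_s}$ decreasingly as $v^{(s)}_1>\cdots>v^{(s)}_{\nu_s}$, $\widetilde\kappa(v^{(s)}_j)=\kappa(v^{(s)}_j)+\nu_s-j$. For $i\in[n]$ set $u_{\sigma^{ -1}(i)}=\sigma^{ -1}(i)+\widetilde\kappa(i)-n$. For $\sigma\in\mathfrak S_n$, prepend $\sigma(0)=0$ and split $0\sigma(1)\cdots\sigma(n)$ into runs, its maximal consecutive decreasing substrings. For $i\in[n]$, $w_{\sigma^{ -1}(i)}(\sigma)$ is the number of entries in the same run as $i$ that are larger than $i$, plus the number of entries smaller than $i$ in the run immediately to the left of the run containing $i$. -}

module Defs where

open import Data.Bool using (Bool; true; false; if_then_else_; not; _∧_; _∨_)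
open import Data.Nat as ℕ using (ℕ; zero; suc; _∸_; _≡ᵇ_; _<ᵇ_; _≤ᵇ_)
open import Data.Integer as ℤ using (ℤ; +_; _-_)
open import Data.List using (List; []; _∷_; _++_; [_]; map; length; upTo; reverse; filterᵇ)
open import Data.Bool.ListAction using (any)
open import Data.List.Relation.Unary.All using (All)
open import Data.List.Relation.Binary.Permutation.Propositional using (_↭_)
open import Data.Maybe using (Maybe; just; nothing)
open import Data.Product using (_×_; _,_; ∃; proj₁; proj₂)
open import Data.Unit using (⊤)
open import Relation.Binary.PropositionalEquality using (_≡_)

IsComposition : List ℕ → Set
IsComposition = All (λ a → 0 ℕ.< a)

-- Components of Ĝ_{μ,ν}.  A component is an integer interval
-- [lo, lo + size - 1] of vertices, either a clique or an independent set.

record Comp : Set where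
  constructor comp
  field
    isClique : Bool
    lo       : ℕ
    size     : ℕ
open Comp public

-- Clique components K_{μ1} = {top, …, top-μ1+1}, K_{μ2} next below, etc.
cliqueComps : ℕ → List ℕ → List Comp
cliqueComps top []       = []
cliqueComps top (a ∷ as) = comp true (suc top ∸ a) a ∷ cliqueComps (top ∸ a) as

-- Independent components I_{ν1} = {start, …, start+ν1-1}, I_{ν2} next above, etc.
indComps : ℕ → List ℕ → List Comp
indComps start []       = []
indComps start (a ∷ as) = comp false start a ∷ indComps (start ℕ.+ a) as

comps : List ℕ → List ℕ → ℕ → List Comp
comps μ ν n = cliqueComps n μ ++ indComps 1 ν

inCompᵇ : Comp → ℕ → Bool
inCompᵇ c v = (lo c ≤ᵇ v) ∧ (v <ᵇ lo c ℕ.+ size c)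

compLookupFrom : ℕ → List Comp → ℕ → Maybe (ℕ × Comp)
compLookupFrom k []       v = nothing
compLookupFrom k (c ∷ cs) v =
  if inCompᵇ c v then just (k , c) else compLookupFrom (suc k) cs v

compLookup : List Comp → ℕ → Maybe (ℕ × Comp)
compLookup = compLookupFrom 0

adjᵇ : List Comp → ℕ → ℕ → Bool
adjᵇ cs u v with compLookup cs u | compLookup cs v
... | just (i , c) | just (j , _) = not (u ≡ᵇ v) ∧ (not (i ≡ᵇ j) ∨ isClique c)
... | _            | _            = false

vertices : ℕ → List ℕ
vertices n = map suc (upTo n)

countᵇ : (ℕ → Bool) → List ℕ → ℕ
countᵇ p xs = length (filterᵇ p xs)

-- The sandpile model on Ĝ_{μ,ν} (sink 0 adjacent to every vertex of [n]).

record Graph : Set where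
  constructor graph
  field
    μ ν : List ℕ
    n   : ℕ

cs : Graph → List Comp
cs (graph μ ν n) = comps μ ν n

-- degree of a non-sink vertex: 1 (edge to the sink) + neighbours in [n]
deg : Graph → ℕ → ℕ
deg G v = suc (countᵇ (λ u → adjᵇ (cs G) u v) (vertices (Graph.n G)))

Config : Set
Config = ℕ → ℤ

Stable : Graph → Config → Set
Stable G κ = ∀ v → 1 ℕ.≤ v → v ℕ.≤ Graph.n G → κ v ℤ.< + deg G v

NonNeg : Graph → Config → Set
NonNeg G κ = ∀ v → 1 ℕ.≤ v → v ℕ.≤ Graph.n G → + 0 ℤ.≤ κ v

toppleSink : Config → Config
toppleSink κ u = κ u ℤ.+ + 1

topple : Graph → ℕ → Config → Config
topple G v κ u =
  if u ≡ᵇ v then κ u - + deg G v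
  else (if adjᵇ (cs G) u v then κ u ℤ.+ + 1 else κ u)

NonNegRun : Graph → Config → List ℕ → Set
NonNegRun G κ []       = ⊤
NonNegRun G κ (v ∷ vs) = NonNeg G (topple G v κ) × NonNegRun G (topple G v κ) vs

Recurrent : Graph → Config → Set
Recurrent G κ =
  Stable G κ ×
  ∃ λ ord → (ord ↭ vertices (Graph.n G)) ×
            NonNeg G (toppleSink κ) × NonNegRun G (toppleSink κ) ord

Sorted : Graph → Config → Set
Sorted G κ = ∀ u v k c → u ℕ.< v →
  compLookup (cs G) u ≡ just (k , c) → compLookup (cs G) v ≡ just (k , c) →
  (if isClique c then κ v ℤ.≤ κ u else κ u ℤ.≤ κ v)

unstableᵇ : Graph → Config → ℕ → Bool
unstableᵇ G κ v = + deg G v ℤ.≤ᵇ κ v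

memᵇ : ℕ → List ℕ → Bool
memᵇ i xs = any (λ x → x ≡ᵇ i) xs

pass : Graph → Config × List ℕ → List ℕ → Config × List ℕ
pass G st [] = st
pass G (κ , out) (i ∷ is) =
  if not (memᵇ i out) ∧ unstableᵇ G κ i
  then pass G (topple G i κ , out ++ [ i ]) is
  else pass G (κ , out) is

passes : Graph → ℕ → Config × List ℕ → Config × List ℕ
passes G zero    st = st
passes G (suc f) st = passes G f (pass G st (reverse (vertices (Graph.n G))))

-- Output word: topple the sink, then perform passes (n passes suffice, and
-- a pass after all vertices have toppled changes nothing).
outputWord : Graph → Config → List ℕ
outputWord G κ = proj₂ (passes G (Graph.n G) (toppleSink κ , []))

-- σ⁻¹(i): 1-based position of i in the word σ (length+1 if absent)
position : List ℕ → ℕ → ℕ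
position []       i = 1
position (x ∷ xs) i = if x ≡ᵇ i then 1 else suc (position xs i)

κtilde : Graph → Config → ℕ → ℤ
κtilde G κ v with compLookup (cs G) v
... | nothing      = κ v
... | just (_ , c) =
  if isClique c then κ v
  else κ v ℤ.+ + (size c ∸ (lo c ℕ.+ size c ∸ v))
  -- v = v_j with j = (lo c + size c - 1) - v + 1, and ν_s = size c

uStat : Graph → Config → List ℕ → ℕ → ℤ
uStat G κ σ i = (+ position σ i ℤ.+ κtilde G κ i) - + Graph.n G

consRun : ℕ → ℕ → List (List ℕ) → List (List ℕ)
consRun x y []       = [ [ x ] ]
consRun x y (r ∷ rs) = if y <ᵇ x then (x ∷ r) ∷ rs else [ x ] ∷ r ∷ rs

runsFrom : ℕ → List ℕ → List (List ℕ)
runsFrom x []       = [ [ x ] ]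
runsFrom x (y ∷ ys) = consRun x y (runsFrom y ys)

runs : List ℕ → List (List ℕ)
runs σ = runsFrom 0 σ

wFrom : ℕ → List ℕ → List (List ℕ) → ℕ
wFrom i prev []       = 0
wFrom i prev (r ∷ rs) =
  if memᵇ i r
  then countᵇ (λ x → i <ᵇ x) r ℕ.+ countᵇ (λ x → x <ᵇ i) prev
  else wFrom i r rs

wStat : List ℕ → ℕ → ℕ
wStat σ i = wFrom i [] (runs σ)

{-# OPTIONS --safe #-}
module Submission where

-- Write P for the position of i in σ, so that 0 σ(1) ⋯ σ(P − 1) lists the sink and the vertices
-- toppled before i.  Just before i topples it carries κ(i) chips plus one for each neighbour in
-- that word, and at least deg(i) of them.  A vertex of [n] other than i that is not adjacent to i
-- lies in the same independent component; sortedness makes the larger ones topple before i and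
-- rules out the smaller ones, which gives n ≤ P + κ̃(i), that is u ≥ 0.
-- For u < w, let α be the last prefix of the word after which i was still stable.  Since the
-- algorithm scans n, …, 1 in passes, the letters between α and i are a decreasing tail of one
-- pass below i followed by a decreasing block of the next pass above i.  The first part ends the
-- run preceding the run of i and the second lies in the run of i, so there are at most w of them,
-- and stability after α gives P + κ̃(i) < n + w.

module ListLemmas where

  open import Data.Bool using (Bool; true; false; not; T)
  open import Data.Bool.Properties using (T-≡)
  open import Data.Empty using (⊥-elim)
  open import Data.List using (List; []; _∷_; _++_; [_]; length; filterᵇ; applyUpTo)
  open import Data.List.Membership.Propositional using (_∈_; _∉_)
  open import Data.List.Membership.Propositional.Properties
    using (∈-++⁺ˡ; ∈-++⁺ʳ; ∈-++⁻; ∈-∃++; ∈-filter⁺; ∈-filter⁻; ∈-applyUpTo⁺; ∈-applyUpTo⁻)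
  open import Data.List.Properties using (length-++; filter-++; length-applyUpTo; ∷-injective)
  open import Data.List.Relation.Binary.Subset.Propositional using (_⊆_)
  open import Data.List.Relation.Unary.All as All using (All; []; _∷_)
  open import Data.List.Relation.Unary.AllPairs using (AllPairs; []; _∷_)
  import Data.List.Relation.Unary.AllPairs.Properties as AllPairsP
  import Data.List.Relation.Unary.Any as Any
  open import Data.List.Relation.Unary.Any using (here; there)
  open import Data.List.Relation.Unary.Any.Properties using (any⁺; any⁻)
  open import Data.List.Relation.Unary.Unique.Propositional using (Unique)
  import Data.List.Relation.Unary.Unique.Propositional.Properties as UniqueP
  open import Data.Nat using (ℕ; suc; _+_; _∸_; _≤_; _<_; _>_; z≤n; s≤s; _≡ᵇ_; _<ᵇ_)
  open import Data.Nat.Properties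
  open import Data.Product using (_×_; _,_; ∃)
  open import Data.Sum using (_⊎_; inj₁; inj₂)
  open import Function using (_∘_; case_of_)
  open import Function.Bundles using (Equivalence)
  open import Relation.Binary.PropositionalEquality hiding ([_])
  open import Relation.Nullary.Decidable using (T?; yes; no)

  open import Defs using (countᵇ; memᵇ)

  Decreasing : List ℕ → Set
  Decreasing = AllPairs _>_

  private
    variable
      x y : ℕ
      xs ys : List ℕ
      p q : ℕ → Bool

  ≡ᵇ-true : ∀ {m n} → m ≡ n → (m ≡ᵇ n) ≡ true
  ≡ᵇ-true {m} refl = Equivalence.to T-≡ (≡⇒≡ᵇ m m refl)

  ≡ᵇ-false : ∀ {m n} → m ≢ n → (m ≡ᵇ n) ≡ false
  ≡ᵇ-false {m} {n} m≢n with m ≡ᵇ n in eq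
  ... | true  = ⊥-elim (m≢n (≡ᵇ⇒≡ m n (subst T (sym eq) _)))
  ... | false = refl

  ≡ᵇ-sym : ∀ m n → (m ≡ᵇ n) ≡ (n ≡ᵇ m)
  ≡ᵇ-sym m n with m ≟ n
  ... | yes refl = refl
  ... | no  m≢n  = trans (≡ᵇ-false m≢n) (sym (≡ᵇ-false (m≢n ∘ sym)))

  <ᵇ-false : ∀ {m n} → m ≤ n → (n <ᵇ m) ≡ false
  <ᵇ-false {m} {n} m≤n with n <ᵇ m in eq
  ... | true  = ⊥-elim (≤⇒≯ m≤n (<ᵇ⇒< n m (subst T (sym eq) _)))
  ... | false = refl

  <ᵇ-true : ∀ {m n} → m < n → (m <ᵇ n) ≡ true
  <ᵇ-true {m} {n} m<n with m <ᵇ n | <⇒<ᵇ m<n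
  ... | true | _ = refl

  memᵇ⇒∈ : T (memᵇ x xs) → x ∈ xs
  memᵇ⇒∈ {x} {xs} t = Any.map (λ {y} y≡ᵇx → sym (≡ᵇ⇒≡ y x y≡ᵇx)) (any⁻ _ xs t)

  ∈⇒memᵇ : x ∈ xs → T (memᵇ x xs)
  ∈⇒memᵇ {x} m = any⁺ _ (Any.map (λ { refl → ≡⇒≡ᵇ x x refl }) m)

  ∈-++-∷-≢ : ∀ ys₁ {ys₂} → x ∈ ys₁ ++ y ∷ ys₂ → x ≢ y → x ∈ ys₁ ++ ys₂
  ∈-++-∷-≢ ys₁ m x≢y with ∈-++⁻ ys₁ m
  ... | inj₁ m₁ = ∈-++⁺ˡ m₁
  ... | inj₂ (here refl) = ⊥-elim (x≢y refl)
  ... | inj₂ (there m₂) = ∈-++⁺ʳ ys₁ m₂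

  ∉-∷ʳ⁻ : ∀ (xs : List ℕ) {x y} → y ∉ xs ++ [ x ] → y ∉ xs × y ≢ x
  ∉-∷ʳ⁻ xs y∉ = (y∉ ∘ ∈-++⁺ˡ) , λ { refl → y∉ (∈-++⁺ʳ xs (here refl)) }

  ∉-∷ʳ⁺ : ∀ (xs : List ℕ) {x y} → y ∉ xs → y ≢ x → y ∉ xs ++ [ x ]
  ∉-∷ʳ⁺ xs y∉xs y≢x m with ∈-++⁻ xs m
  ... | inj₁ m′ = y∉xs m′
  ... | inj₂ (here y≡x) = y≢x y≡x

  ∷ʳ-⊆ : ∀ (xs : List ℕ) {ys x} → xs ⊆ ys → x ∈ ys → xs ++ [ x ] ⊆ ys
  ∷ʳ-⊆ xs xs⊆ys x∈ys m with ∈-++⁻ xs m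
  ... | inj₁ m′ = xs⊆ys m′
  ... | inj₂ (here refl) = x∈ys

  ∷ʳ-split : ∀ (xs : List ℕ) {x} pre {i} post → xs ++ [ x ] ≡ pre ++ i ∷ post →
    (pre ≡ xs × i ≡ x) ⊎ ∃ λ post′ → xs ≡ pre ++ i ∷ post′
  ∷ʳ-split []       []            []      refl = inj₁ (refl , refl)
  ∷ʳ-split []       []            (_ ∷ _) ()
  ∷ʳ-split []       (_ ∷ [])      _       ()
  ∷ʳ-split []       (_ ∷ _ ∷ _)   _       ()
  ∷ʳ-split (y ∷ xs) []            post    refl = inj₂ (xs , refl)
  ∷ʳ-split (y ∷ xs) (p ∷ pre)     post    eq with ∷-injective eq
  ... | refl , eq′ with ∷ʳ-split xs pre post eq′
  ...   | inj₁ (refl , refl) = inj₁ (refl , refl)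
  ...   | inj₂ (post′ , refl) = inj₂ (post′ , refl)

  Unique-++⁻ˡ : ∀ (xs : List ℕ) {ys} → Unique (xs ++ ys) → Unique xs
  Unique-++⁻ˡ []       _         = []
  Unique-++⁻ˡ (x ∷ xs) (x≢ ∷ u) = All.tabulate (λ m → All.lookup x≢ (∈-++⁺ˡ m)) ∷ Unique-++⁻ˡ xs u

  Unique-++-∷⇒∉ : ∀ (xs : List ℕ) {ys} → Unique (xs ++ y ∷ ys) → y ∉ xs
  Unique-++-∷⇒∉ (x ∷ xs) {ys} (x≢ ∷ u) (here refl) = All.lookup x≢ (∈-++⁺ʳ xs {x ∷ ys} (here refl)) refl
  Unique-++-∷⇒∉ (x ∷ xs) (x≢ ∷ u) (there m)   = Unique-++-∷⇒∉ xs u m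

  Unique-∷ʳ : ∀ (xs : List ℕ) → Unique xs → x ∉ xs → Unique (xs ++ [ x ])
  Unique-∷ʳ xs u x∉ = UniqueP.++⁺ u ([] ∷ []) λ { (m , here refl) → x∉ m }

  length-≤-⊆ : Unique xs → xs ⊆ ys → length xs ≤ length ys
  length-≤-⊆ {[]} _ _ = z≤n
  length-≤-⊆ {x ∷ xs} {ys} (x≢xs ∷ u) xs⊆ys with ∈-∃++ (xs⊆ys (here refl))
  ... | ys₁ , ys₂ , refl = begin
    suc (length xs)           ≤⟨ s≤s (length-≤-⊆ u xs⊆ys₁ys₂) ⟩
    suc (length (ys₁ ++ ys₂)) ≡⟨ cong suc (length-++ ys₁) ⟩
    suc (length ys₁ + length ys₂) ≡⟨ sym (+-suc (length ys₁) (length ys₂)) ⟩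
    length ys₁ + length (x ∷ ys₂) ≡⟨ sym (length-++ ys₁) ⟩
    length (ys₁ ++ x ∷ ys₂)   ∎
    where
    open ≤-Reasoning
    xs⊆ys₁ys₂ : xs ⊆ ys₁ ++ ys₂
    xs⊆ys₁ys₂ m = ∈-++-∷-≢ ys₁ (xs⊆ys (there m)) (λ { refl → All.lookup x≢xs m refl })

  length-<-⊆ : Unique xs → xs ⊆ ys → y ∈ ys → y ∉ xs → length xs < length ys
  length-<-⊆ {xs} {ys} {y} u xs⊆ys y∈ys y∉xs with ∈-∃++ y∈ys
  ... | ys₁ , ys₂ , refl = begin-strict
    length xs                     ≤⟨ length-≤-⊆ u (λ m → ∈-++-∷-≢ ys₁ (xs⊆ys m) (λ { refl → y∉xs m })) ⟩
    length (ys₁ ++ ys₂)           ≡⟨ length-++ ys₁ ⟩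
    length ys₁ + length ys₂       <⟨ +-monoʳ-< (length ys₁) ≤-refl ⟩
    length ys₁ + length (y ∷ ys₂) ≡⟨ sym (length-++ ys₁) ⟩
    length (ys₁ ++ y ∷ ys₂)       ∎
    where open ≤-Reasoning

  AllPairs-++⁻ʳ : ∀ {R : ℕ → ℕ → Set} (xs : List ℕ) {ys} → AllPairs R (xs ++ ys) → AllPairs R ys
  AllPairs-++⁻ʳ []       p       = p
  AllPairs-++⁻ʳ (x ∷ xs) (_ ∷ p) = AllPairs-++⁻ʳ xs p

  AllPairs-∷ʳ : ∀ {R : ℕ → ℕ → Set} {xs x} → AllPairs R xs → All (λ y → R y x) xs → AllPairs R (xs ++ [ x ])
  AllPairs-∷ʳ p r = AllPairsP.++⁺ p ([] ∷ []) (All.map (_∷ []) r)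

  AllPairs-∷ʳ⁻ : ∀ {R : ℕ → ℕ → Set} (xs : List ℕ) {x} → AllPairs R (xs ++ [ x ]) → All (λ y → R y x) xs
  AllPairs-∷ʳ⁻ []       _         = []
  AllPairs-∷ʳ⁻ (y ∷ xs) (r ∷ p)   = All.lookup r (∈-++⁺ʳ xs (here refl)) ∷ AllPairs-∷ʳ⁻ xs p

  countᵇ-++ : ∀ p xs ys → countᵇ p (xs ++ ys) ≡ countᵇ p xs + countᵇ p ys
  countᵇ-++ p xs ys = trans (cong length (filter-++ (T? ∘ p) xs ys)) (length-++ (filterᵇ p xs))

  countᵇ-≤-length : ∀ p xs → countᵇ p xs ≤ length xs
  countᵇ-≤-length p [] = z≤n
  countᵇ-≤-length p (x ∷ xs) with p x
  ... | true  = s≤s (countᵇ-≤-length p xs)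
  ... | false = m≤n⇒m≤1+n (countᵇ-≤-length p xs)

  countᵇ-+-not : ∀ p xs → countᵇ p xs + countᵇ (not ∘ p) xs ≡ length xs
  countᵇ-+-not p [] = refl
  countᵇ-+-not p (x ∷ xs) with p x
  ... | true  = cong suc (countᵇ-+-not p xs)
  ... | false = trans (+-suc _ _) (cong suc (countᵇ-+-not p xs))

  countᵇ-mono : (∀ {x} → x ∈ xs → T (p x) → T (q x)) → countᵇ p xs ≤ countᵇ q xs
  countᵇ-mono {[]} h = z≤n
  countᵇ-mono {x ∷ xs} {p} {q} h with p x | q x | h (here refl)
  ... | true  | true  | _ = s≤s (countᵇ-mono (h ∘ there))
  ... | true  | false | h₀ = ⊥-elim (h₀ _)
  ... | false | true  | _ = m≤n⇒m≤1+n (countᵇ-mono (h ∘ there))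
  ... | false | false | _ = countᵇ-mono (h ∘ there)

  countᵇ-cong : (∀ {x} → x ∈ xs → p x ≡ q x) → countᵇ p xs ≡ countᵇ q xs
  countᵇ-cong h = ≤-antisym (countᵇ-mono (λ m → subst T (h m))) (countᵇ-mono (λ m → subst T (sym (h m))))

  countᵇ-all : (∀ {x} → x ∈ xs → T (p x)) → countᵇ p xs ≡ length xs
  countᵇ-all {[]} h = refl
  countᵇ-all {x ∷ xs} {p} h with p x | h (here refl)
  ... | true | _ = cong suc (countᵇ-all (h ∘ there))

  countᵇ-pos : ∀ p xs → 0 < countᵇ p xs → ∃ λ x → x ∈ xs × T (p x)
  countᵇ-pos p (x ∷ xs) pos with p x in px
  ... | true  = x , here refl , subst T (sym px) _
  ... | false with countᵇ-pos p xs pos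
  ...   | y , m , py = y , there m , py

  countᵇ-suffix : ∀ p xs ys → countᵇ p ys ≤ countᵇ p (xs ++ ys)
  countᵇ-suffix p xs ys = ≤-trans (m≤n+m _ (countᵇ p xs)) (≤-reflexive (sym (countᵇ-++ p xs ys)))

  countᵇ-infix : ∀ p xs ys zs → countᵇ p ys ≤ countᵇ p (xs ++ ys ++ zs)
  countᵇ-infix p xs ys zs =
    ≤-trans (≤-trans (m≤m+n _ _) (≤-reflexive (sym (countᵇ-++ p ys zs)))) (countᵇ-suffix p xs (ys ++ zs))

  countᵇ-≤-⊆ : Unique xs → (∀ {x} → x ∈ xs → T (p x) → x ∈ ys × T (q x)) → countᵇ p xs ≤ countᵇ q ys
  countᵇ-≤-⊆ {p = p} {q = q} u h = length-≤-⊆ (UniqueP.filter⁺ (T? ∘ p) u) λ m →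
    let m₁ , px = ∈-filter⁻ (T? ∘ p) m
        m₂ , qx = h m₁ px
    in ∈-filter⁺ (T? ∘ q) m₂ qx

  length-≤-countᵇ-⊆ : Unique ys → (∀ {x} → x ∈ ys → x ∈ xs × T (q x)) → length ys ≤ countᵇ q xs
  length-≤-countᵇ-⊆ {ys} uys ys→xs =
    ≤-trans (≤-reflexive (sym (countᵇ-all {ys} {λ _ → true} _))) (countᵇ-≤-⊆ uys λ m _ → ys→xs m)

  countᵇ-≤-length-⊆ : Unique xs → (∀ {x} → x ∈ xs → T (p x) → x ∈ ys) → countᵇ p xs ≤ length ys
  countᵇ-≤-length-⊆ {ys = ys} uxs xs→ys =
    ≤-trans (countᵇ-≤-⊆ {q = λ _ → true} uxs λ m px → xs→ys m px , _) (countᵇ-≤-length _ ys)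

  countᵇ-≡-length : Unique xs → Unique ys →
    (∀ {x} → x ∈ xs → T (p x) → x ∈ ys) → (∀ {x} → x ∈ ys → x ∈ xs × T (p x)) →
    countᵇ p xs ≡ length ys
  countᵇ-≡-length uxs uys xs→ys ys→xs = ≤-antisym (countᵇ-≤-length-⊆ uxs xs→ys) (length-≤-countᵇ-⊆ uys ys→xs)

  range : ℕ → ℕ → List ℕ
  range a k = applyUpTo (a +_) k

  ∈-range⁺ : ∀ {a k} → a ≤ x → x < a + k → x ∈ range a k
  ∈-range⁺ {x} {a} {k} a≤x x<a+k = subst (_∈ range a k) (m+[n∸m]≡n a≤x)
    (∈-applyUpTo⁺ (a +_) (+-cancelˡ-< a (x ∸ a) k (subst (_< a + k) (sym (m+[n∸m]≡n a≤x)) x<a+k)))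

  ∈-range⁻ : ∀ {a k} → x ∈ range a k → a ≤ x × x < a + k
  ∈-range⁻ {a = a} m with j , j<k , refl ← ∈-applyUpTo⁻ (a +_) m = m≤m+n a j , +-monoʳ-< a j<k

  range-unique : ∀ a k → Unique (range a k)
  range-unique a k = UniqueP.applyUpTo⁺₁ (a +_) k (λ i<j _ → <⇒≢ (+-monoʳ-< a i<j))

  length-range : ∀ a k → length (range a k) ≡ k
  length-range a = length-applyUpTo (a +_)

module Runs where

  open import Data.Bool using (true; false; T)
  open import Data.Empty using (⊥-elim)
  open import Data.List using (List; []; _∷_; _++_; [_]; length; concat)
  open import Data.List.Membership.Propositional using (_∈_; _∉_)
  open import Data.List.Membership.Propositional.Properties using (∈-++⁺ˡ; ∈-++⁺ʳ)
  open import Data.List.Properties using (++-assoc)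
  open import Data.List.Relation.Binary.Subset.Propositional using (_⊆_)
  open import Data.List.Relation.Unary.All as All using (All; []; _∷_)
  open import Data.List.Relation.Unary.AllPairs using ([]; _∷_)
  open import Data.List.Relation.Unary.Any using (here; there)
  open import Data.Nat using (ℕ; suc; _+_; _≤_; _<_; _<ᵇ_)
  open import Data.Nat.Properties
  open import Data.Product using (_×_; _,_; ∃; ∃₂)
  open import Function using (_∘_)
  open import Relation.Binary.PropositionalEquality hiding ([_])

  open import Defs
  open ListLemmas

  -- runs σ is runsW (0 ∷ σ).
  runsW : List ℕ → List (List ℕ)
  runsW []       = []
  runsW (x ∷ ys) = runsFrom x ys

  lastOr : List ℕ → List (List ℕ) → List ℕ
  lastOr p []       = p
  lastOr p (r ∷ rs) = lastOr r rs

  lastOf : ℕ → List ℕ → ℕ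
  lastOf x []       = x
  lastOf x (y ∷ ys) = lastOf y ys

  runsFrom-head : ∀ x ys → ∃₂ λ r rs → runsFrom x ys ≡ (x ∷ r) ∷ rs
  runsFrom-head x []       = [] , [] , refl
  runsFrom-head x (y ∷ ys) with r , rs , eq ← runsFrom-head y ys rewrite eq with y <ᵇ x
  ... | true  = y ∷ r , rs , refl
  ... | false = [] , (y ∷ r) ∷ rs , refl

  concat-runsFrom : ∀ x ys → concat (runsFrom x ys) ≡ x ∷ ys
  concat-runsFrom x []       = refl
  concat-runsFrom x (y ∷ ys) with r , rs , eq ← runsFrom-head y ys | concat-runsFrom y ys
  ... | ih rewrite eq with y <ᵇ x
  ... | true  = cong (x ∷_) ih
  ... | false = cong (x ∷_) ih

  runsFrom-ascent : ∀ x ys {z} zs → lastOf x ys < z → runsFrom x (ys ++ z ∷ zs) ≡ runsFrom x ys ++ runsFrom z zs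
  runsFrom-ascent x [] {z} zs x<z with r , rs , eq ← runsFrom-head z zs rewrite eq | <ᵇ-false (<⇒≤ x<z) = refl
  runsFrom-ascent x (y ∷ ys) zs last<z rewrite runsFrom-ascent y ys zs last<z with r , rs , eq ← runsFrom-head y ys
    rewrite eq with y <ᵇ x
  ... | true  = refl
  ... | false = refl

  runsFrom-desc : ∀ x ys zs → Decreasing (x ∷ ys) → ∃₂ λ r rs → runsFrom x (ys ++ zs) ≡ ((x ∷ ys) ++ r) ∷ rs
  runsFrom-desc x []       zs _                = runsFrom-head x zs
  runsFrom-desc x (y ∷ ys) zs ((y<x ∷ _) ∷ d) with r , rs , eq ← runsFrom-desc y ys zs d
    rewrite eq | <ᵇ-true y<x = r , rs , refl

  runsFrom-desc-all : ∀ x ys → Decreasing (x ∷ ys) → runsFrom x ys ≡ [ x ∷ ys ]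
  runsFrom-desc-all x []       _                = refl
  runsFrom-desc-all x (y ∷ ys) ((y<x ∷ _) ∷ d) rewrite runsFrom-desc-all y ys d | <ᵇ-true y<x = refl

  private
    lastOr-∷ˡ : ∀ {p s} t rs → lastOr p rs ≡ s → ∃ λ t′ → lastOr (t ++ p) rs ≡ t′ ++ s
    lastOr-∷ˡ t []       refl = t , refl
    lastOr-∷ˡ t (r ∷ rs) eq   = [] , eq

    lastOr-consRun : ∀ x y r rs → ∃ λ t → lastOr [] (consRun x y (r ∷ rs)) ≡ t ++ lastOr r rs
    lastOr-consRun x y r rs with y <ᵇ x
    ... | true  = lastOr-∷ˡ [ x ] rs refl
    ... | false = [] , refl

    lastOr-runsFrom-∷ : ∀ a h w → ∃ λ t → lastOr [] (runsFrom a (h ∷ w)) ≡ t ++ lastOr [] (runsFrom h w)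
    lastOr-runsFrom-∷ a h w with r , rs , head ← runsFrom-head h w rewrite head = lastOr-consRun a h (h ∷ r) rs

  lastRun-suffix : ∀ A {g gs} → Decreasing (g ∷ gs) → ∃ λ t → lastOr [] (runsW (A ++ g ∷ gs)) ≡ t ++ g ∷ gs
  lastRun-suffix [] {g} {gs} d rewrite runsFrom-desc-all g gs d = [] , refl
  lastRun-suffix (a ∷ A) {g} {gs} d with t , eq ← lastRun-suffix A d = extend A eq
    where
    extend′ : ∀ h w → lastOr [] (runsFrom h w) ≡ t ++ g ∷ gs →
      ∃ λ t′ → lastOr [] (runsFrom a (h ∷ w)) ≡ t′ ++ g ∷ gs
    extend′ h w eq with t₁ , eq₁ ← lastOr-runsFrom-∷ a h w =
      t₁ ++ t , trans eq₁ (trans (cong (t₁ ++_) eq) (sym (++-assoc t₁ t (g ∷ gs))))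

    extend : ∀ A → lastOr [] (runsW (A ++ g ∷ gs)) ≡ t ++ g ∷ gs →
      ∃ λ t′ → lastOr [] (runsW (a ∷ A ++ g ∷ gs)) ≡ t′ ++ g ∷ gs
    extend []       = extend′ g gs
    extend (b ∷ A)  = extend′ b (A ++ g ∷ gs)

  wFrom-++ : ∀ i prev rs₁ rs₂ → i ∉ concat rs₁ → wFrom i prev (rs₁ ++ rs₂) ≡ wFrom i (lastOr prev rs₁) rs₂
  wFrom-++ i prev []        rs₂ _  = refl
  wFrom-++ i prev (r ∷ rs₁) rs₂ i∉ with memᵇ i r in i∈r
  ... | true  = ⊥-elim (i∉ (∈-++⁺ˡ {ys = concat rs₁} (memᵇ⇒∈ {xs = r} (subst T (sym i∈r) _))))
  ... | false = wFrom-++ i r rs₁ rs₂ (i∉ ∘ ∈-++⁺ʳ r)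

  wFrom-∷ : ∀ i prev r rs → i ∈ r → wFrom i prev (r ∷ rs) ≡ countᵇ (i <ᵇ_) r + countᵇ (_<ᵇ i) prev
  wFrom-∷ i prev r rs i∈r with memᵇ i r | ∈⇒memᵇ i∈r
  ... | true | _ = refl

  Block : List ℕ → List (List ℕ) → List ℕ → Set
  Block D runs A = ∃₂ λ rs₁ t → ∃₂ λ r rs → runs ≡ rs₁ ++ (t ++ D ++ r) ∷ rs × concat rs₁ ⊆ A

  private
    consRun-Block : ∀ x a {D A rs₀} → Block D rs₀ A → Block D (consRun x a rs₀) (x ∷ A)
    consRun-Block x a ([] , t , r , rs , refl , _) with a <ᵇ x
    ... | true  = [] , x ∷ t , r , rs , refl , λ ()
    ... | false = [ [ x ] ] , t , r , rs , refl , λ { (here refl) → here refl }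
    consRun-Block x a ((r₁ ∷ rs₁) , t , r , rs , refl , ⊆A) with a <ᵇ x
    ... | true  = (x ∷ r₁) ∷ rs₁ , t , r , rs , refl , λ { (here refl) → here refl ; (there m) → there (⊆A m) }
    ... | false = [ x ] ∷ r₁ ∷ rs₁ , t , r , rs , refl , λ { (here refl) → here refl ; (there m) → there (⊆A m) }

    runsFrom-Block : ∀ x A d ds post → Decreasing (d ∷ ds) → Block (d ∷ ds) (runsFrom x (A ++ d ∷ ds ++ post)) (x ∷ A)
    runsFrom-Block x []      d ds post desc with r , rs , eq ← runsFrom-desc d ds post desc rewrite eq =
      consRun-Block x d ([] , [] , r , rs , refl , λ ())
    runsFrom-Block x (a ∷ A) d ds post desc = consRun-Block x a (runsFrom-Block a A d ds post desc)

  runsW-Block : ∀ A d ds post → Decreasing (d ∷ ds) → Block (d ∷ ds) (runsW (A ++ d ∷ ds ++ post)) A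
  runsW-Block []      d ds post desc with r , rs , eq ← runsFrom-desc d ds post desc = [] , [] , r , rs , eq , λ ()
  runsW-Block (x ∷ A) d ds post desc = runsFrom-Block x A d ds post desc

  private
    lastOf-∈ : ∀ x ys → lastOf x ys ∈ x ∷ ys
    lastOf-∈ x []       = here refl
    lastOf-∈ x (y ∷ ys) = there (lastOf-∈ y ys)

    lastOf-++ : ∀ x A g gs → lastOf x (A ++ g ∷ gs) ≡ lastOf g gs
    lastOf-++ x []      g gs = refl
    lastOf-++ x (a ∷ A) g gs = lastOf-++ a A g gs

  runsW-ascent : ∀ A g gs {z} zs → All (_< z) (g ∷ gs) → runsW (A ++ g ∷ gs ++ z ∷ zs) ≡ runsW (A ++ g ∷ gs) ++ runsFrom z zs
  runsW-ascent []      g gs zs <z = runsFrom-ascent g gs zs (All.lookup <z (lastOf-∈ g gs))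
  runsW-ascent (a ∷ A) g gs {z} zs <z = trans (cong (runsFrom a) (sym (++-assoc A (g ∷ gs) (z ∷ zs))))
    (runsFrom-ascent a (A ++ g ∷ gs) zs (subst (_< z) (sym (lastOf-++ a A g gs)) (All.lookup <z (lastOf-∈ g gs))))

  concat-runsW : ∀ w → concat (runsW w) ≡ w
  concat-runsW []       = refl
  concat-runsW (x ∷ ys) = concat-runsFrom x ys

  w-≥-larger : ∀ i A d ds post → i ∉ A → Decreasing (d ∷ ds) → i ∈ d ∷ ds →
    countᵇ (i <ᵇ_) (d ∷ ds) ≤ wFrom i [] (runsW (A ++ d ∷ ds ++ post))
  w-≥-larger i A d ds post i∉A desc i∈D with rs₁ , t , r , rs , eq , ⊆A ← runsW-Block A d ds post desc = begin
    countᵇ (i <ᵇ_) (d ∷ ds)                                                ≤⟨ countᵇ-infix (i <ᵇ_) t (d ∷ ds) r ⟩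
    countᵇ (i <ᵇ_) (t ++ (d ∷ ds) ++ r)                                    ≤⟨ m≤m+n _ _ ⟩
    countᵇ (i <ᵇ_) (t ++ (d ∷ ds) ++ r) + countᵇ (_<ᵇ i) (lastOr [] rs₁)
      ≡⟨ sym (wFrom-∷ i (lastOr [] rs₁) _ rs (∈-++⁺ʳ t (∈-++⁺ˡ i∈D))) ⟩
    wFrom i (lastOr [] rs₁) ((t ++ (d ∷ ds) ++ r) ∷ rs)                    ≡⟨ sym (wFrom-++ i [] rs₁ _ (i∉A ∘ ⊆A)) ⟩
    wFrom i [] (rs₁ ++ (t ++ (d ∷ ds) ++ r) ∷ rs)                          ≡⟨ cong (wFrom i []) (sym eq) ⟩
    wFrom i [] (runsW (A ++ d ∷ ds ++ post))                               ∎
    where open ≤-Reasoning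

  w-≥-larger+smaller : ∀ i A g gs d ds post → i ∉ A ++ g ∷ gs → Decreasing (g ∷ gs) → All (_< d) (g ∷ gs) →
    Decreasing (d ∷ ds) → i ∈ d ∷ ds →
    countᵇ (i <ᵇ_) (d ∷ ds) + countᵇ (_<ᵇ i) (g ∷ gs) ≤ wFrom i [] (runsW (A ++ g ∷ gs ++ d ∷ ds ++ post))
  w-≥-larger+smaller i A g gs d ds post i∉ desc₁ <d desc i∈D
    with r , rs , eq ← runsFrom-desc d ds post desc | t , last≡ ← lastRun-suffix A desc₁ = begin
    countᵇ (i <ᵇ_) (d ∷ ds) + countᵇ (_<ᵇ i) (g ∷ gs)
      ≤⟨ +-mono-≤ (countᵇ-infix (i <ᵇ_) [] (d ∷ ds) r)
                  (subst (λ l → _ ≤ countᵇ (_<ᵇ i) l) (sym last≡) (countᵇ-suffix (_<ᵇ i) t (g ∷ gs))) ⟩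
    countᵇ (i <ᵇ_) ((d ∷ ds) ++ r) + countᵇ (_<ᵇ i) (lastOr [] first)
      ≡⟨ sym (wFrom-∷ i (lastOr [] first) _ rs (∈-++⁺ˡ i∈D)) ⟩
    wFrom i (lastOr [] first) (((d ∷ ds) ++ r) ∷ rs)                    ≡⟨ sym (wFrom-++ i [] first _ i∉first) ⟩
    wFrom i [] (first ++ ((d ∷ ds) ++ r) ∷ rs)
      ≡⟨ cong (λ rs′ → wFrom i [] (first ++ rs′)) (sym eq) ⟩
    wFrom i [] (first ++ runsFrom d (ds ++ post))
      ≡⟨ cong (wFrom i []) (sym (runsW-ascent A g gs (ds ++ post) <d)) ⟩
    wFrom i [] (runsW (A ++ g ∷ gs ++ d ∷ ds ++ post))                  ∎
    where
    open ≤-Reasoning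
    first = runsW (A ++ g ∷ gs)
    i∉first : i ∉ concat first
    i∉first = i∉ ∘ subst (i ∈_) (concat-runsW (A ++ g ∷ gs))

  private
    ∷ʳ-∷ : ∀ (xs : List ℕ) x → ∃₂ λ d ds → xs ++ [ x ] ≡ d ∷ ds
    ∷ʳ-∷ []       x = x , [] , refl
    ∷ʳ-∷ (y ∷ xs) x = y , xs ++ [ x ] , refl

    head-∷ʳ-≥ : ∀ γ {i d ds} → Decreasing (γ ++ [ i ]) → γ ++ [ i ] ≡ d ∷ ds → i ≤ d
    head-∷ʳ-≥ []      _          refl = ≤-refl
    head-∷ʳ-≥ (y ∷ γ) (y>γi ∷ _) refl = <⇒≤ (All.lookup y>γi (∈-++⁺ʳ γ (here refl)))

  w-bound : ∀ i α γ₁ γ₂ post → i ∉ α ++ γ₁ ++ γ₂ → Decreasing γ₁ → All (_< i) γ₁ → Decreasing (γ₂ ++ [ i ]) →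
    length γ₁ + length γ₂ ≤ wFrom i [] (runsW (α ++ γ₁ ++ γ₂ ++ i ∷ post))
  w-bound i α γ₁ γ₂ post i∉ desc₁ γ₁<i desc₂ with d , ds , D≡ ← ∷ʳ-∷ γ₂ i = bound γ₁ i∉ desc₁ γ₁<i
    where
    tail≡ : γ₂ ++ i ∷ post ≡ d ∷ ds ++ post
    tail≡ = trans (sym (++-assoc γ₂ [ i ] post)) (cong (_++ post) D≡)

    larger : length γ₂ ≤ countᵇ (i <ᵇ_) (d ∷ ds)
    larger = begin
      length γ₂                      ≡⟨ sym (countᵇ-all (λ m → <⇒<ᵇ (All.lookup (AllPairs-∷ʳ⁻ γ₂ desc₂) m))) ⟩
      countᵇ (i <ᵇ_) γ₂              ≤⟨ countᵇ-infix (i <ᵇ_) [] γ₂ [ i ] ⟩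
      countᵇ (i <ᵇ_) (γ₂ ++ [ i ])   ≡⟨ cong (countᵇ (i <ᵇ_)) D≡ ⟩
      countᵇ (i <ᵇ_) (d ∷ ds)        ∎
      where open ≤-Reasoning

    i∈D : i ∈ d ∷ ds
    i∈D = subst (i ∈_) D≡ (∈-++⁺ʳ γ₂ (here refl))

    bound : ∀ γ₁ → i ∉ α ++ γ₁ ++ γ₂ → Decreasing γ₁ → All (_< i) γ₁ →
      length γ₁ + length γ₂ ≤ wFrom i [] (runsW (α ++ γ₁ ++ γ₂ ++ i ∷ post))
    bound [] i∉ _ _ = subst (λ w → length γ₂ ≤ wFrom i [] (runsW (α ++ w))) (sym tail≡)
      (≤-trans larger (w-≥-larger i α d ds post (i∉ ∘ ∈-++⁺ˡ) (subst Decreasing D≡ desc₂) i∈D))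
    bound (g ∷ gs) i∉ desc₁ γ₁<i = subst (λ w → length (g ∷ gs) + length γ₂ ≤ wFrom i [] (runsW (α ++ g ∷ gs ++ w)))
      (sym tail≡) (begin
        length (g ∷ gs) + length γ₂                          ≡⟨ +-comm (length (g ∷ gs)) _ ⟩
        length γ₂ + length (g ∷ gs)
          ≤⟨ +-mono-≤ larger (≤-reflexive (sym (countᵇ-all (λ m → <⇒<ᵇ (All.lookup γ₁<i m))))) ⟩
        countᵇ (i <ᵇ_) (d ∷ ds) + countᵇ (_<ᵇ i) (g ∷ gs)
          ≤⟨ w-≥-larger+smaller i α g gs d ds post i∉αγ₁ desc₁ γ₁<d (subst Decreasing D≡ desc₂) i∈D ⟩
        wFrom i [] (runsW (α ++ g ∷ gs ++ d ∷ ds ++ post))   ∎)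
      where
      open ≤-Reasoning
      i∉αγ₁ : i ∉ α ++ g ∷ gs
      i∉αγ₁ = i∉ ∘ subst (i ∈_) (++-assoc α (g ∷ gs) γ₂) ∘ ∈-++⁺ˡ
      γ₁<d : All (_< d) (g ∷ gs)
      γ₁<d = All.map (λ x<i → <-≤-trans x<i (head-∷ʳ-≥ γ₂ desc₂ D≡)) γ₁<i

  position-++-∷ : ∀ pre {i} post → i ∉ pre → position (pre ++ i ∷ post) i ≡ suc (length pre)
  position-++-∷ []        {i} post _  rewrite ≡ᵇ-true (refl {x = i}) = refl
  position-++-∷ (x ∷ pre) {i} post i∉ rewrite ≡ᵇ-false {x} {i} (λ { refl → i∉ (here refl) }) =
    cong suc (position-++-∷ pre post (i∉ ∘ there))

module Components where

  open import Data.Bool using (Bool; true; false; not; _∧_; _∨_; T)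
  open import Data.Bool.Properties using (T-∧; T-∨; ∧-zeroʳ)
  open import Data.Empty using (⊥-elim)
  open import Data.List using (List; []; _∷_; length)
  open import Data.List.Membership.Propositional using (_∈_)
  open import Data.List.Properties using (map-applyUpTo)
  open import Data.List.Relation.Unary.All as All using (All; []; _∷_)
  import Data.List.Relation.Unary.All.Properties as AllP
  open import Data.List.Relation.Unary.AllPairs using (AllPairs; []; _∷_)
  import Data.List.Relation.Unary.AllPairs.Properties as AllPairsP
  open import Data.List.Relation.Unary.Any using (Any; here; there)
  import Data.List.Relation.Unary.Any.Properties as AnyP
  open import Data.List.Relation.Unary.Unique.Propositional using (Unique)
  open import Data.Maybe using (Maybe; just)
  open import Data.Nat using (ℕ; suc; _+_; _∸_; _≤_; _<_; z≤n; s≤s; _≡ᵇ_; _≤?_; _<?_)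
  open import Data.Nat.ListAction using (sum)
  open import Data.Nat.Properties
  open import Data.Nat.Tactic.RingSolver using (solve-∀)
  open import Data.Product using (_×_; _,_; ∃₂; proj₁; proj₂)
  open import Data.Sum using (_⊎_; inj₁; inj₂)
  open import Function using (_∘_; id; case_of_)
  open import Function.Bundles using (Equivalence)
  open import Relation.Binary.PropositionalEquality
  open import Relation.Nullary using (¬_; yes; no)

  open import Defs
  open ListLemmas

  private
    variable
      u v k a : ℕ
      c d : Comp
      L : List Comp

  InComp : Comp → ℕ → Set
  InComp c v = lo c ≤ v × v < lo c + size c

  inCompᵇ⇒InComp : T (inCompᵇ c v) → InComp c v
  inCompᵇ⇒InComp {c} {v} t with Equivalence.to T-∧ t
  ... | l , u = ≤ᵇ⇒≤ (lo c) v l , <ᵇ⇒< v (lo c + size c) u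

  InComp⇒inCompᵇ : InComp c v → T (inCompᵇ c v)
  InComp⇒inCompᵇ (l , u) = Equivalence.from T-∧ (≤⇒≤ᵇ l , <⇒<ᵇ u)

  Apart : Comp → Comp → Set
  Apart c d = lo c + size c ≤ lo d ⊎ lo d + size d ≤ lo c

  Apart⇒¬InComp : Apart c d → InComp c v → ¬ InComp d v
  Apart⇒¬InComp (inj₁ c<d) (_ , v<c) (d≤v , _) = <-irrefl refl (<-≤-trans v<c (≤-trans c<d d≤v))
  Apart⇒¬InComp (inj₂ d<c) (c≤v , _) (_ , v<d) = <-irrefl refl (<-≤-trans v<d (≤-trans d<c c≤v))

  lookup-InComp : ∀ {P : Comp → Set} k L → All P L →
    compLookupFrom k L v ≡ just (a , c) → P c × InComp c v
  lookup-InComp {v} k (d ∷ L) (pd ∷ pL) eq with inCompᵇ d v in v∈d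
  lookup-InComp k (d ∷ L) (pd ∷ pL) refl | true = pd , inCompᵇ⇒InComp {d} (subst T (sym v∈d) _)
  ... | false = lookup-InComp (suc k) L pL eq

  lookup-index-≥ : ∀ k L → compLookupFrom k L v ≡ just (a , c) → k ≤ a
  lookup-index-≥ {v} k (d ∷ L) eq with inCompᵇ d v
  lookup-index-≥ k (d ∷ L) refl | true = ≤-refl
  ... | false = ≤-trans (n≤1+n k) (lookup-index-≥ (suc k) L eq)

  lookup-index-injective : ∀ k L → compLookupFrom k L u ≡ just (a , c) → compLookupFrom k L v ≡ just (a , d) → c ≡ d
  lookup-index-injective {u} {v = v} k (e ∷ L) eq₁ eq₂ with inCompᵇ e u | inCompᵇ e v
  lookup-index-injective k (e ∷ L) refl refl | true  | true  = refl
  lookup-index-injective k (e ∷ L) refl eq₂  | true  | false = ⊥-elim (<-irrefl refl (lookup-index-≥ (suc k) L eq₂))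
  lookup-index-injective k (e ∷ L) eq₁ refl  | false | true  = ⊥-elim (<-irrefl refl (lookup-index-≥ (suc k) L eq₁))
  lookup-index-injective k (e ∷ L) eq₁ eq₂   | false | false = lookup-index-injective (suc k) L eq₁ eq₂

  lookup-apart : ∀ k L → AllPairs Apart L → compLookupFrom k L u ≡ just (a , c) → InComp c v →
    compLookupFrom k L v ≡ just (a , c)
  lookup-apart {u} {v = v} k (e ∷ L) (e#L ∷ apart) eq v∈c with inCompᵇ e u
  lookup-apart {v = v} k (e ∷ L) _ refl v∈c | true with inCompᵇ e v | InComp⇒inCompᵇ {e} v∈c
  ... | true | _ = refl
  lookup-apart {c = c} {v = v} k (e ∷ L) (e#L ∷ apart) eq v∈c | false with inCompᵇ e v in v∈e
  ... | true  = ⊥-elim (Apart⇒¬InComp {c = e} {d = c} (proj₁ (lookup-InComp {P = Apart e} (suc k) L e#L eq))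
                                    (inCompᵇ⇒InComp {e} (subst T (sym v∈e) _)) v∈c)
  ... | false = lookup-apart (suc k) L apart eq v∈c

  lookup-complete : ∀ k L → Any (λ c → InComp c v) L → ∃₂ λ a c → compLookupFrom k L v ≡ just (a , c)
  lookup-complete {v} k (e ∷ L) v∈L with inCompᵇ e v in v∈e
  ... | true = k , e , refl
  lookup-complete {v} k (e ∷ L) (here v∈e′) | false = ⊥-elim (subst T v∈e (InComp⇒inCompᵇ {e} v∈e′))
  lookup-complete {v} k (e ∷ L) (there v∈L) | false = lookup-complete (suc k) L v∈L

  Within : ℕ → ℕ → Comp → Set
  Within l h c = l ≤ lo c × lo c + size c ≤ h

  All-Within-weaken : ∀ {l l′ h h′ cs} → l′ ≤ l → h ≤ h′ → All (Within l h) cs → All (Within l′ h′) cs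
  All-Within-weaken l′≤l h≤h′ = All.map λ (l≤ , ≤h) → ≤-trans l′≤l l≤ , ≤-trans ≤h h≤h′

  private
    shift : ∀ b a r → suc (b + (a + r)) ≡ a + suc (b + r)
    shift = solve-∀

    swap : ∀ b a r → b + (a + r) ≡ a + (b + r)
    swap = solve-∀

    top : ∀ b a r → suc (b + r) + a ≡ suc (b + (a + r))
    top = solve-∀

  cliqueComps-∷ : ∀ b a r μ →
    cliqueComps (b + (a + r)) (a ∷ μ) ≡ comp true (suc (b + r)) a ∷ cliqueComps (b + r) μ
  cliqueComps-∷ b a r μ = cong₂ (λ l t → comp true l a ∷ cliqueComps t μ)
    (trans (cong (_∸ a) (shift b a r)) (m+n∸m≡n a _))
    (trans (cong (_∸ a) (swap b a r)) (m+n∸m≡n a _))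

  cliqueComps-within : ∀ b μ → All (Within (suc b) (suc (b + sum μ))) (cliqueComps (b + sum μ) μ)
  cliqueComps-within b [] = []
  cliqueComps-within b (a ∷ μ) rewrite cliqueComps-∷ b a (sum μ) μ =
    (s≤s (m≤m+n b (sum μ)) , ≤-reflexive (top b a (sum μ))) ∷
    All-Within-weaken ≤-refl (s≤s (+-monoʳ-≤ b (m≤n+m (sum μ) a))) (cliqueComps-within b μ)

  cliqueComps-apart : ∀ b μ → AllPairs Apart (cliqueComps (b + sum μ) μ)
  cliqueComps-apart b [] = []
  cliqueComps-apart b (a ∷ μ) rewrite cliqueComps-∷ b a (sum μ) μ =
    All.map (inj₂ ∘ proj₂) (cliqueComps-within b μ) ∷ cliqueComps-apart b μ

  cliqueComps-cover : ∀ b μ → b < v → v ≤ b + sum μ → Any (λ c → InComp c v) (cliqueComps (b + sum μ) μ)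
  cliqueComps-cover b [] b<v v≤b = ⊥-elim (<-irrefl refl (<-≤-trans b<v (subst (_ ≤_) (+-identityʳ b) v≤b)))
  cliqueComps-cover {v} b (a ∷ μ) b<v v≤top rewrite cliqueComps-∷ b a (sum μ) μ with v ≤? b + sum μ
  ... | yes v≤b+r = there (cliqueComps-cover b μ b<v v≤b+r)
  ... | no  v≰b+r = here (≰⇒> v≰b+r , subst (v <_) (sym (top b a (sum μ))) (s≤s v≤top))

  indComps-within : ∀ s ν → All (Within s (s + sum ν)) (indComps s ν)
  indComps-within s [] = []
  indComps-within s (a ∷ ν) = (≤-refl , +-monoʳ-≤ s (m≤m+n a (sum ν))) ∷
    All-Within-weaken (m≤m+n s a) (≤-reflexive (+-assoc s a (sum ν))) (indComps-within (s + a) ν)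

  indComps-apart : ∀ s ν → AllPairs Apart (indComps s ν)
  indComps-apart s [] = []
  indComps-apart s (a ∷ ν) = All.map (inj₁ ∘ proj₁) (indComps-within (s + a) ν) ∷ indComps-apart (s + a) ν

  indComps-cover : ∀ s ν → s ≤ v → v < s + sum ν → Any (λ c → InComp c v) (indComps s ν)
  indComps-cover s [] s≤v v<s = ⊥-elim (<-irrefl refl (≤-<-trans s≤v (subst (_ <_) (+-identityʳ s) v<s)))
  indComps-cover {v} s (a ∷ ν) s≤v v<top with v <? s + a
  ... | yes v<s+a = here (s≤v , v<s+a)
  ... | no  v≮s+a = there (indComps-cover (s + a) ν (≮⇒≥ v≮s+a) (subst (v <_) (sym (+-assoc s a (sum ν))) v<top))

  vertices≡range : ∀ n → vertices n ≡ range 1 n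
  vertices≡range n = map-applyUpTo id suc n

  ∈-vertices⁺ : ∀ {n} → 1 ≤ v → v ≤ n → v ∈ vertices n
  ∈-vertices⁺ {n = n} 1≤v v≤n rewrite vertices≡range n = ∈-range⁺ 1≤v (s≤s v≤n)

  ∈-vertices⁻ : ∀ {n} → v ∈ vertices n → 1 ≤ v × v ≤ n
  ∈-vertices⁻ {n = n} m rewrite vertices≡range n with ∈-range⁻ m
  ... | 1≤v , s≤s v≤n = 1≤v , v≤n

  vertices-unique : ∀ n → Unique (vertices n)
  vertices-unique n rewrite vertices≡range n = range-unique 1 n

  length-vertices : ∀ n → length (vertices n) ≡ n
  length-vertices n rewrite vertices≡range n = length-range 1 n

  siblingᵇ : Comp → ℕ → Bool
  siblingᵇ c x = not (isClique c) ∧ inCompᵇ c x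

  nonAdjᵇ : Comp → ℕ → ℕ → Bool
  nonAdjᵇ c i x = (x ≡ᵇ i) ∨ siblingᵇ c x

  T-siblingᵇ⇒ : ∀ {x} → T (siblingᵇ c x) → isClique c ≡ false × InComp c x
  T-siblingᵇ⇒ {c} {x} t with isClique c | inCompᵇ c x in x∈c
  ... | false | true = refl , inCompᵇ⇒InComp {c} (subst T (sym x∈c) _)

  ⇒T-siblingᵇ : ∀ {x} → isClique c ≡ false → InComp c x → T (siblingᵇ c x)
  ⇒T-siblingᵇ {c} indep x∈c rewrite indep = InComp⇒inCompᵇ {c} x∈c

  T-nonAdjᵇ⇒ : ∀ {i x} → T (nonAdjᵇ c i x) → x ≡ i ⊎ T (siblingᵇ c x)
  T-nonAdjᵇ⇒ {c} {i} {x} t = case Equivalence.to T-∨ t of λ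
    { (inj₁ x≡ᵇi) → inj₁ (≡ᵇ⇒≡ x i x≡ᵇi)
    ; (inj₂ sibling) → inj₂ sibling }

  module Vertices (μ ν : List ℕ) (n : ℕ) (n≡ : n ≡ sum μ + sum ν) where

    G : Graph
    G = graph μ ν n

    CS : List Comp
    CS = comps μ ν n

    lookup : ℕ → Maybe (ℕ × Comp)
    lookup = compLookup CS

    private
      n≡ν+μ : n ≡ sum ν + sum μ
      n≡ν+μ = trans n≡ (+-comm (sum μ) (sum ν))

    comps-within : All (Within 1 (suc n)) CS
    comps-within rewrite n≡ν+μ = AllP.++⁺
      (All-Within-weaken (s≤s z≤n) ≤-refl (cliqueComps-within (sum ν) μ))
      (All-Within-weaken ≤-refl (s≤s (m≤m+n (sum ν) (sum μ))) (indComps-within 1 ν))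

    comps-apart : AllPairs Apart CS
    comps-apart rewrite n≡ν+μ = AllPairsP.++⁺ (cliqueComps-apart (sum ν) μ) (indComps-apart 1 ν)
      (All.map (λ clique-within → All.map (λ ind-within → inj₂ (≤-trans (proj₂ ind-within) (proj₁ clique-within)))
        (indComps-within 1 ν)) (cliqueComps-within (sum ν) μ))

    comps-cover : v ∈ vertices n → Any (λ c → InComp c v) CS
    comps-cover {v} v∈V with ∈-vertices⁻ v∈V
    ... | 1≤v , v≤n rewrite n≡ν+μ with v ≤? sum ν
    ... | yes v≤ν = AnyP.++⁺ʳ (cliqueComps (sum ν + sum μ) μ) (indComps-cover 1 ν 1≤v (s≤s v≤ν))
    ... | no  v≰ν = AnyP.++⁺ˡ (cliqueComps-cover (sum ν) μ (≰⇒> v≰ν) v≤n)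

    lookup-total : v ∈ vertices n → ∃₂ λ k c → lookup v ≡ just (k , c)
    lookup-total v∈V = lookup-complete 0 CS (comps-cover v∈V)

    lookup-within : lookup v ≡ just (k , c) → Within 1 (suc n) c × InComp c v
    lookup-within = lookup-InComp 0 CS comps-within

    lookup-same : lookup u ≡ just (k , c) → InComp c v → lookup v ≡ just (k , c)
    lookup-same = lookup-apart 0 CS comps-apart

    InComp⇒∈vertices : lookup u ≡ just (k , c) → InComp c v → v ∈ vertices n
    InComp⇒∈vertices eu (lo≤v , v<hi) with (1≤lo , hi≤n+1) , _ ← lookup-within eu =
      ∈-vertices⁺ (≤-trans 1≤lo lo≤v) (≤-pred (≤-trans v<hi hi≤n+1))

    private
      adjᵇ-lookup : ∀ {k′ c′} → lookup u ≡ just (k , c) → lookup v ≡ just (k′ , c′) →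
        adjᵇ CS u v ≡ not (u ≡ᵇ v) ∧ (not (k ≡ᵇ k′) ∨ isClique c)
      adjᵇ-lookup eu ev rewrite eu | ev = refl

      same-comp : ∀ b cl → not b ∧ (not true ∨ cl) ≡ not (b ∨ (not cl ∧ true))
      same-comp false false = refl
      same-comp false true  = refl
      same-comp true  _     = refl

      other-comp : ∀ b cl → not b ∧ (not false ∨ cl) ≡ not (b ∨ (not cl ∧ false))
      other-comp false false = refl
      other-comp false true  = refl
      other-comp true  _     = refl

      lookup-index-≢ : ∀ {k′ c′ x} → lookup u ≡ just (k , c) → lookup x ≡ just (k′ , c′) → ¬ T (inCompᵇ c x) → k′ ≢ k
      lookup-index-≢ {c = c} eu ex x∉c refl with refl ← lookup-index-injective 0 CS eu ex =
        x∉c (InComp⇒inCompᵇ {c} (proj₂ (lookup-within ex)))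

    adjᵇ-nonAdjᵇ : ∀ {i x} → lookup i ≡ just (k , c) → x ∈ vertices n →
      adjᵇ CS x i ≡ not (nonAdjᵇ c i x) × adjᵇ CS i x ≡ not (nonAdjᵇ c i x)
    adjᵇ-nonAdjᵇ {k} {c} {i} {x} ei x∈V with k′ , c′ , ex ← lookup-total x∈V | inCompᵇ c x in x∈c
    ... | true with refl ← trans (sym ex) (lookup-same ei (inCompᵇ⇒InComp {c} (subst T (sym x∈c) _)))
      rewrite adjᵇ-lookup ex ei | adjᵇ-lookup ei ex | ≡ᵇ-true (refl {x = k}) | ≡ᵇ-sym i x =
      same-comp (x ≡ᵇ i) (isClique c) , same-comp (x ≡ᵇ i) (isClique c)
    ... | false
      rewrite adjᵇ-lookup ex ei | adjᵇ-lookup ei ex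
            | ≡ᵇ-false (lookup-index-≢ ei ex (subst T x∈c)) | ≡ᵇ-false (lookup-index-≢ ei ex (subst T x∈c) ∘ sym)
            | ≡ᵇ-sym i x =
      other-comp (x ≡ᵇ i) (isClique c) , other-comp (x ≡ᵇ i) (isClique c)

    adjᵇ-sym : ∀ {i x} → i ∈ vertices n → x ∈ vertices n → adjᵇ CS i x ≡ adjᵇ CS x i
    adjᵇ-sym i∈V x∈V with _ , _ , ei ← lookup-total i∈V =
      trans (proj₂ (adjᵇ-nonAdjᵇ ei x∈V)) (sym (proj₁ (adjᵇ-nonAdjᵇ ei x∈V)))

    adj₀ᵇ : ℕ → ℕ → Bool
    adj₀ᵇ i x = (x ≡ᵇ 0) ∨ adjᵇ CS i x

    adj₀ᵇ-vertex : ∀ {i x} → x ∈ vertices n → adj₀ᵇ i x ≡ adjᵇ CS i x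
    adj₀ᵇ-vertex {x = x} x∈V rewrite ≡ᵇ-false {x} {0} (λ { refl → case proj₁ (∈-vertices⁻ x∈V) of λ () }) = refl

    adj₀ᵇ-sibling : ∀ {i x} → lookup i ≡ just (k , c) → x ∈ 0 ∷ vertices n → x ≢ i → adj₀ᵇ i x ≡ not (siblingᵇ c x)
    adj₀ᵇ-sibling {c = c} ei (here refl) _ with inCompᵇ c 0 in 0∈c
    ... | false = sym (cong not (∧-zeroʳ (not (isClique c))))
    ... | true with (1≤lo , _) , _ ← lookup-within ei | (lo≤0 , _) ← inCompᵇ⇒InComp {c} (subst T (sym 0∈c) _) =
      ⊥-elim (case ≤-trans 1≤lo lo≤0 of λ ())
    adj₀ᵇ-sibling {c = c} {i} {x} ei (there x∈V) x≢i
      rewrite adj₀ᵇ-vertex {i} x∈V | proj₂ (adjᵇ-nonAdjᵇ ei x∈V) | ≡ᵇ-false x≢i = refl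

    sibling⇒¬adj₀ᵇ : ∀ {i x} → lookup i ≡ just (k , c) → x ∈ 0 ∷ vertices n → x ≢ i → T (siblingᵇ c x) → ¬ T (adj₀ᵇ i x)
    sibling⇒¬adj₀ᵇ {c = c} {x = x} ei x∈0V x≢i sibling adjacent with siblingᵇ c x | adj₀ᵇ-sibling ei x∈0V x≢i
    ... | true | eq = subst T eq adjacent

    deg-+-nonAdj : ∀ {i} → lookup i ≡ just (k , c) → deg G i + countᵇ (nonAdjᵇ c i) (vertices n) ≡ suc n
    deg-+-nonAdj {c = c} {i} ei = cong suc (begin
      countᵇ (λ x → adjᵇ CS x i) (vertices n) + countᵇ (nonAdjᵇ c i) (vertices n)
        ≡⟨ cong (_+ countᵇ (nonAdjᵇ c i) (vertices n)) (countᵇ-cong (proj₁ ∘ adjᵇ-nonAdjᵇ ei)) ⟩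
      countᵇ (not ∘ nonAdjᵇ c i) (vertices n) + countᵇ (nonAdjᵇ c i) (vertices n)
        ≡⟨ +-comm (countᵇ (not ∘ nonAdjᵇ c i) (vertices n)) _ ⟩
      countᵇ (nonAdjᵇ c i) (vertices n) + countᵇ (not ∘ nonAdjᵇ c i) (vertices n)
        ≡⟨ countᵇ-+-not (nonAdjᵇ c i) (vertices n) ⟩
      length (vertices n)
        ≡⟨ length-vertices n ⟩
      n ∎)
      where open ≡-Reasoning

    countᵇ-nonAdjᵇ-clique : ∀ {i} → lookup i ≡ just (k , c) → isClique c ≡ true → countᵇ (nonAdjᵇ c i) (vertices n) ≡ 1
    countᵇ-nonAdjᵇ-clique {c = c} {i} ei clique = countᵇ-≡-length (vertices-unique n) ([] ∷ [])
      (λ _ t → case T-nonAdjᵇ⇒ {c} t of λ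
        { (inj₁ refl) → here refl
        ; (inj₂ sibling) → ⊥-elim (case trans (sym clique) (proj₁ (T-siblingᵇ⇒ {c} sibling)) of λ ()) })
      (λ { (here refl) → InComp⇒∈vertices ei (proj₂ (lookup-within ei)) , Equivalence.from T-∨ (inj₁ (≡⇒≡ᵇ i i refl)) })

    countᵇ-nonAdjᵇ-indep : ∀ {i} → lookup i ≡ just (k , c) → isClique c ≡ false → countᵇ (nonAdjᵇ c i) (vertices n) ≡ size c
    countᵇ-nonAdjᵇ-indep {c = c} {i} ei indep = trans (countᵇ-≡-length (vertices-unique n) (range-unique (lo c) (size c))
      (λ _ t → case T-nonAdjᵇ⇒ {c} t of λ
        { (inj₁ refl) → InComp⇒∈range (proj₂ (lookup-within ei))
        ; (inj₂ sibling) → InComp⇒∈range (proj₂ (T-siblingᵇ⇒ {c} sibling)) })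
      (λ m → let x∈c = ∈-range⁻ m in
        InComp⇒∈vertices ei x∈c , Equivalence.from T-∨ (inj₂ (⇒T-siblingᵇ {c} indep x∈c))))
      (length-range (lo c) (size c))
      where
      InComp⇒∈range : InComp c v → v ∈ range (lo c) (size c)
      InComp⇒∈range (l , h) = ∈-range⁺ l h

    deg-same-comp : ∀ {i x} → lookup i ≡ just (k , c) → lookup x ≡ just (k , c) → deg G i ≡ deg G x
    deg-same-comp {c = c} {i} {x} ei ex = +-cancelʳ-≡ _ (deg G i) (deg G x) (begin
      deg G i + countᵇ (nonAdjᵇ c x) (vertices n) ≡⟨ cong (λ m → deg G i + m) (sym (same-count (isClique c) refl)) ⟩
      deg G i + countᵇ (nonAdjᵇ c i) (vertices n) ≡⟨ trans (deg-+-nonAdj ei) (sym (deg-+-nonAdj ex)) ⟩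
      deg G x + countᵇ (nonAdjᵇ c x) (vertices n) ∎)
      where
      open ≡-Reasoning
      same-count : ∀ b → isClique c ≡ b → countᵇ (nonAdjᵇ c i) (vertices n) ≡ countᵇ (nonAdjᵇ c x) (vertices n)
      same-count true  cl = trans (countᵇ-nonAdjᵇ-clique ei cl) (sym (countᵇ-nonAdjᵇ-clique ex cl))
      same-count false cl = trans (countᵇ-nonAdjᵇ-indep ei cl) (sym (countᵇ-nonAdjᵇ-indep ex cl))

module Algorithm where

  open import Data.Bool using (Bool; true; false; not; _∧_; T; if_then_else_)
  open import Data.Empty using (⊥-elim)
  open import Data.Integer as ℤ using (ℤ; +_; -[1+_]; +≤+)
  import Data.Integer.Properties as ℤ
  open import Data.List using (List; []; _∷_; _++_; [_]; length; foldl; reverse; applyDownFrom)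
  open import Data.List.Membership.Propositional using (_∈_; _∉_)
  open import Data.List.Membership.Propositional.Properties
    using (∈-++⁺ˡ; ∈-++⁺ʳ; ∈-++⁻; ∈-applyDownFrom⁺; ∈-applyDownFrom⁻)
  open import Data.List.Properties using (foldl-++; ++-assoc; ++-identityʳ; length-++; reverse-applyUpTo)
  open import Data.List.Relation.Binary.Permutation.Propositional using (_↭_; ↭-sym; ↭⇒↭ₛ)
  open import Data.List.Relation.Binary.Permutation.Propositional.Properties using (∈-resp-↭)
  open import Data.List.Relation.Binary.Subset.Propositional using (_⊆_)
  open import Data.List.Relation.Unary.Any using (here; there)
  open import Data.List.Relation.Unary.Unique.Propositional using (Unique; [])
  open import Data.Nat using (ℕ; zero; suc; _+_; _≤_; z≤n; s≤s)
  open import Data.Nat.ListAction using (sum)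
  open import Data.Nat.Properties
  open import Data.Product using (_×_; _,_; ∃; proj₁; proj₂)
  open import Data.Sum using (_⊎_; inj₁; inj₂)
  open import Function using (_∘_; case_of_)
  open import Relation.Binary.PropositionalEquality hiding ([_])
  open import Relation.Binary.PropositionalEquality.Properties using (setoid)
  open import Relation.Nullary using (¬_; yes; no)
  open import Data.List.Relation.Binary.Permutation.Setoid.Properties (setoid ℕ) using (Unique-resp-↭)
  open import Data.List.Membership.DecPropositional _≟_ using (_∈?_)

  open import Defs
  open ListLemmas
  open Components

  private
    variable
      v : ℕ
      out xs : List ℕ

  module Toppling (μ ν : List ℕ) (n : ℕ) (n≡ : n ≡ sum μ + sum ν) (κ : Config) where

    open Vertices μ ν n n≡ public

    configAfter : List ℕ → Config
    configAfter = foldl (λ K x → topple G x K) (toppleSink κ)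

    configAfter-∷ʳ : ∀ out j → configAfter (out ++ [ j ]) ≡ topple G j (configAfter out)
    configAfter-∷ʳ out j = foldl-++ (λ K x → topple G x K) (toppleSink κ) out [ j ]

    topple-other : ∀ K {x} → x ≢ v → topple G x K v ≡ K v ℤ.+ + countᵇ (adjᵇ CS v) [ x ]
    topple-other {v} K {x} x≢v rewrite ≡ᵇ-false (x≢v ∘ sym) with adjᵇ CS v x
    ... | true  = refl
    ... | false = sym (ℤ.+-identityʳ (K v))

    foldl-topple-∉ : ∀ K xs → v ∉ xs → foldl (λ K x → topple G x K) K xs v ≡ K v ℤ.+ + countᵇ (adjᵇ CS v) xs
    foldl-topple-∉ K [] _ = sym (ℤ.+-identityʳ (K _))
    foldl-topple-∉ {v} K (x ∷ xs) v∉ = begin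
      foldl _ (topple G x K) xs v
        ≡⟨ foldl-topple-∉ (topple G x K) xs (v∉ ∘ there) ⟩
      topple G x K v ℤ.+ + countᵇ (adjᵇ CS v) xs
        ≡⟨ cong (ℤ._+ _) (topple-other K (λ { refl → v∉ (here refl) })) ⟩
      K v ℤ.+ + countᵇ (adjᵇ CS v) [ x ] ℤ.+ + countᵇ (adjᵇ CS v) xs
        ≡⟨ ℤ.+-assoc (K v) _ _ ⟩
      K v ℤ.+ + (countᵇ (adjᵇ CS v) [ x ] + countᵇ (adjᵇ CS v) xs)
        ≡⟨ cong (λ m → K v ℤ.+ + m) (sym (countᵇ-++ (adjᵇ CS v) [ x ] xs)) ⟩
      K v ℤ.+ + countᵇ (adjᵇ CS v) (x ∷ xs) ∎
      where open ≡-Reasoning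

    configAfter-∉ : out ⊆ vertices n → v ∉ out → configAfter out v ≡ κ v ℤ.+ + countᵇ (adj₀ᵇ v) (0 ∷ out)
    configAfter-∉ {out} {v} out⊆V v∉out = begin
      configAfter out v
        ≡⟨ foldl-topple-∉ (toppleSink κ) out v∉out ⟩
      κ v ℤ.+ + 1 ℤ.+ + countᵇ (adjᵇ CS v) out
        ≡⟨ ℤ.+-assoc (κ v) (+ 1) _ ⟩
      κ v ℤ.+ + suc (countᵇ (adjᵇ CS v) out)
        ≡⟨ cong (λ m → κ v ℤ.+ + suc m) (countᵇ-cong (sym ∘ adj₀ᵇ-vertex ∘ out⊆V)) ⟩
      κ v ℤ.+ + countᵇ (adj₀ᵇ v) (0 ∷ out) ∎
      where open ≡-Reasoning

    topple-self : ∀ K w → topple G w K w ≡ K w ℤ.- + deg G w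
    topple-self K w rewrite ≡ᵇ-true (refl {x = w}) = refl

    toppled-unstable : ∀ K {w} → w ∈ vertices n → NonNeg G (topple G w K) → + deg G w ℤ.≤ K w
    toppled-unstable K {w} w∈V nn with 1≤w , w≤n ← ∈-vertices⁻ w∈V
      = ℤ.0≤i-j⇒j≤i (subst (+ 0 ℤ.≤_) (topple-self K w) (nn w 1≤w w≤n))

    countᵇ-adj₀ᵇ-≤-deg : ∀ {w pre} → w ∈ vertices n → Unique pre → pre ⊆ vertices n →
      countᵇ (adj₀ᵇ w) (0 ∷ pre) ≤ deg G w
    countᵇ-adj₀ᵇ-≤-deg w∈V u pre⊆V = s≤s (countᵇ-≤-⊆ u λ m t →
      pre⊆V m , subst T (trans (adj₀ᵇ-vertex (pre⊆V m)) (adjᵇ-sym w∈V (pre⊆V m))) t)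

    nonneg-from : ∀ k {c d} → + d ℤ.≤ k ℤ.+ + c → c ≤ d → + 0 ℤ.≤ k
    nonneg-from (+ _)     _ _ = +≤+ z≤n
    nonneg-from -[1+ m ] {c} h c≤d =
      ⊥-elim (ℤ.<-irrefl refl (ℤ.≤-<-trans h (ℤ.<-≤-trans (ℤ.+-monoˡ-< (+ c) ℤ.-<+) (+≤+ c≤d))))

    Stuck : List ℕ → Set
    Stuck out = ∀ {v} → v ∈ vertices n → v ∉ out → ¬ T (unstableᵇ G (configAfter out) v)

    module LegalRun {ord} (ord-unique : Unique ord) (ord⊆V : ord ⊆ vertices n) where

      private
        ∷-split : ∀ pre {w post} → pre ++ w ∷ post ≡ ord → (pre ++ [ w ]) ++ post ≡ ord
        ∷-split pre {w} {post} refl = ++-assoc pre [ w ] post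

      unstable-when-toppled : ∀ pre {w post} → pre ++ w ∷ post ≡ ord → NonNeg G (topple G w (configAfter pre)) →
        + deg G w ℤ.≤ κ w ℤ.+ + countᵇ (adj₀ᵇ w) (0 ∷ pre)
      unstable-when-toppled pre refl nn =
        subst (_ ℤ.≤_) (configAfter-∉ (ord⊆V ∘ ∈-++⁺ˡ) (Unique-++-∷⇒∉ pre ord-unique))
          (toppled-unstable (configAfter pre) (ord⊆V (∈-++⁺ʳ pre (here refl))) nn)

      run-nonneg : ∀ pre post → pre ++ post ≡ ord → NonNegRun G (configAfter pre) post → ∀ {v} → v ∈ post → + 0 ℤ.≤ κ v
      run-nonneg pre (w ∷ post) refl (nn , _) (here refl) =
        nonneg-from (κ w) (unstable-when-toppled pre refl nn)
          (countᵇ-adj₀ᵇ-≤-deg (ord⊆V (∈-++⁺ʳ pre (here refl))) (Unique-++⁻ˡ pre ord-unique) (ord⊆V ∘ ∈-++⁺ˡ))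
      run-nonneg pre (w ∷ post) eq (_ , run) (there m) =
        run-nonneg (pre ++ [ w ]) post (∷-split pre eq) (subst (λ K → NonNegRun G K post) (sym (configAfter-∷ʳ pre w)) run) m

      run-⊆ : ∀ pre post → pre ++ post ≡ ord → NonNegRun G (configAfter pre) post →
        ∀ {out} → out ⊆ vertices n → pre ⊆ out → Stuck out → post ⊆ out
      run-⊆ pre (w ∷ post) eq (nn , run) {out} out⊆V pre⊆out stuck (here refl) with w ∈? out
      ... | yes w∈out = w∈out
      ... | no  w∉out = ⊥-elim (stuck (ord⊆V (subst (w ∈_) eq (∈-++⁺ʳ pre (here refl)))) w∉out (ℤ.≤⇒≤ᵇ (begin
        + deg G w                                  ≤⟨ unstable-when-toppled pre eq nn ⟩
        κ w ℤ.+ + countᵇ (adj₀ᵇ w) (0 ∷ pre)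
          ≤⟨ ℤ.+-monoʳ-≤ (κ w) (+≤+ (s≤s (countᵇ-≤-⊆ pre-unique λ m t → pre⊆out m , t))) ⟩
        κ w ℤ.+ + countᵇ (adj₀ᵇ w) (0 ∷ out)      ≡⟨ sym (configAfter-∉ out⊆V w∉out) ⟩
        configAfter out w                          ∎)))
        where
        open ℤ.≤-Reasoning
        pre-unique : Unique pre
        pre-unique = Unique-++⁻ˡ pre (subst Unique (sym eq) ord-unique)
      run-⊆ pre (w ∷ post) eq (nn , run) out⊆V pre⊆out stuck (there m) =
        run-⊆ (pre ++ [ w ]) post (∷-split pre eq) (subst (λ K → NonNegRun G K post) (sym (configAfter-∷ʳ pre w)) run)
          out⊆V (∷ʳ-⊆ pre pre⊆out (run-⊆ pre (w ∷ post) eq (nn , run) out⊆V pre⊆out stuck (here refl))) stuck m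

    topplesᵇ : List ℕ → ℕ → Bool
    topplesᵇ out i = not (memᵇ i out) ∧ unstableᵇ G (configAfter out) i

    passOut : List ℕ → List ℕ → List ℕ
    passOut out []       = out
    passOut out (i ∷ is) = if topplesᵇ out i then passOut (out ++ [ i ]) is else passOut out is

    passesOut : ℕ → List ℕ → List ℕ
    passesOut zero    out = out
    passesOut (suc f) out = passesOut f (passOut out (applyDownFrom suc n))

    pass≡passOut : ∀ out is → pass G (configAfter out , out) is ≡ (configAfter (passOut out is) , passOut out is)
    pass≡passOut out [] = refl
    pass≡passOut out (i ∷ is) with topplesᵇ out i
    ... | true rewrite sym (configAfter-∷ʳ out i) = pass≡passOut (out ++ [ i ]) is
    ... | false = pass≡passOut out is

    reverse-vertices : reverse (vertices n) ≡ applyDownFrom suc n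
    reverse-vertices = trans (cong reverse (vertices≡range n)) (reverse-applyUpTo suc n)

    passes≡passesOut : ∀ f out → passes G f (configAfter out , out) ≡ (configAfter (passesOut f out) , passesOut f out)
    passes≡passesOut zero    out = refl
    passes≡passesOut (suc f) out
      rewrite reverse-vertices | pass≡passOut out (applyDownFrom suc n) =
      passes≡passesOut f (passOut out (applyDownFrom suc n))

    outputWord≡passesOut : outputWord G κ ≡ passesOut n []
    outputWord≡passesOut = cong proj₂ (passes≡passesOut n [])

    PartialWord : List ℕ → Set
    PartialWord out = Unique out × out ⊆ vertices n

    topplesᵇ⇒ : ∀ {out i} → T (topplesᵇ out i) → i ∉ out × T (unstableᵇ G (configAfter out) i)
    topplesᵇ⇒ {out} {i} t with memᵇ i out in i∈? | unstableᵇ G (configAfter out) i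
    ... | false | true = (λ i∈out → subst T i∈? (∈⇒memᵇ i∈out)) , _

    ¬topplesᵇ⇒ : ∀ {out i} → ¬ T (topplesᵇ out i) → i ∉ out → ¬ T (unstableᵇ G (configAfter out) i)
    ¬topplesᵇ⇒ {out} {i} ¬t i∉out with memᵇ i out in i∈? | unstableᵇ G (configAfter out) i
    ... | true  | _ = λ _ → i∉out (memᵇ⇒∈ (subst T (sym i∈?) _))
    ... | false | _ = ¬t

    configAfter-mono-∷ʳ : ∀ out {j i} → i ≢ j → configAfter out i ℤ.≤ configAfter (out ++ [ j ]) i
    configAfter-mono-∷ʳ out {j} {i} i≢j = begin
      configAfter out i                                          ≤⟨ ℤ.i≤i+j (configAfter out i) (+ countᵇ (adjᵇ CS i) [ j ]) ⟩
      configAfter out i ℤ.+ + countᵇ (adjᵇ CS i) [ j ]           ≡⟨ sym (topple-other (configAfter out) (i≢j ∘ sym)) ⟩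
      topple G j (configAfter out) i                             ≡⟨ cong (λ K → K i) (sym (configAfter-∷ʳ out j)) ⟩
      configAfter (out ++ [ j ]) i                               ∎
      where open ℤ.≤-Reasoning

    unstable-∷ʳ : ∀ out {j i} → i ≢ j →
      T (unstableᵇ G (configAfter out) i) → T (unstableᵇ G (configAfter (out ++ [ j ])) i)
    unstable-∷ʳ out {i = i} i≢j t = ℤ.≤⇒≤ᵇ (ℤ.≤-trans (ℤ.≤ᵇ⇒≤ {+ deg G i} t) (configAfter-mono-∷ʳ out i≢j))

    downFrom-⊆ : applyDownFrom suc n ⊆ vertices n
    downFrom-⊆ m with _ , i<n , refl ← ∈-applyDownFrom⁻ suc m = ∈-vertices⁺ (s≤s z≤n) i<n

    passOut-extends : ∀ out is → PartialWord out → is ⊆ vertices n →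
      ∃ λ ext → passOut out is ≡ out ++ ext × PartialWord (out ++ ext)
    passOut-extends out [] pw _ = [] , sym (++-identityʳ out) , subst PartialWord (sym (++-identityʳ out)) pw
    passOut-extends out (i ∷ is) (u , out⊆V) is⊆V with topplesᵇ out i in t
    ... | true with ext , eq , pw ← passOut-extends (out ++ [ i ]) is
                     (Unique-∷ʳ out u (proj₁ (topplesᵇ⇒ (subst T (sym t) _))) , ∷ʳ-⊆ out out⊆V (is⊆V (here refl))) (is⊆V ∘ there)
      = i ∷ ext , trans eq (++-assoc out [ i ] ext) , subst PartialWord (++-assoc out [ i ] ext) pw
    ... | false = passOut-extends out is (u , out⊆V) (is⊆V ∘ there)

    passesOut-extends : ∀ f out → PartialWord out → ∃ λ ext → passesOut f out ≡ out ++ ext × PartialWord (out ++ ext)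
    passesOut-extends zero out pw = passOut-extends out [] pw λ ()
    passesOut-extends (suc f) out pw
      with ext₁ , eq₁ , pw₁ ← passOut-extends out (applyDownFrom suc n) pw downFrom-⊆
      rewrite eq₁
      with ext₂ , eq₂ , pw₂ ← passesOut-extends f (out ++ ext₁) pw₁
      = ext₁ ++ ext₂ , trans eq₂ (++-assoc out ext₁ ext₂) , subst PartialWord (++-assoc out ext₁ ext₂) pw₂

    passOut-⊇ : ∀ out is {x} → x ∈ out → x ∈ passOut out is
    passOut-⊇ out []       m = m
    passOut-⊇ out (i ∷ is) m with topplesᵇ out i
    ... | true  = passOut-⊇ (out ++ [ i ]) is (∈-++⁺ˡ m)
    ... | false = passOut-⊇ out is m

    passOut-scan : ∀ out is {i} → i ∈ is → i ∉ out → T (unstableᵇ G (configAfter out) i) → i ∈ passOut out is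
    passOut-scan out (j ∷ is) (here refl) i∉out u with topplesᵇ out j in t
    ... | true  = passOut-⊇ (out ++ [ j ]) is (∈-++⁺ʳ out (here refl))
    ... | false = ⊥-elim (¬topplesᵇ⇒ (subst T t) i∉out u)
    passOut-scan out (j ∷ is) {i} (there m) i∉out u with topplesᵇ out j
    ... | false = passOut-scan out is m i∉out u
    ... | true with i ≟ j
    ...   | yes refl = passOut-⊇ (out ++ [ i ]) is (∈-++⁺ʳ out (here refl))
    ...   | no  i≢j  = passOut-scan (out ++ [ j ]) is m (∉-∷ʳ⁺ out i∉out i≢j) (unstable-∷ʳ out i≢j u)

    vertices-⊆-downFrom : vertices n ⊆ applyDownFrom suc n
    vertices-⊆-downFrom {v} m with ∈-vertices⁻ m
    ... | s≤s _ , v≤n = ∈-applyDownFrom⁺ suc v≤n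

    passOut-fixed⇒Stuck : ∀ {out} → passOut out (applyDownFrom suc n) ≡ out → Stuck out
    passOut-fixed⇒Stuck fixed v∈V v∉out u = v∉out (subst (_ ∈_) fixed (passOut-scan _ _ (vertices-⊆-downFrom v∈V) v∉out u))

    module _ (recurrent : Recurrent G κ) where

      private
        ord : List ℕ
        ord = proj₁ (proj₂ recurrent)

        ord↭V : ord ↭ vertices n
        ord↭V = proj₁ (proj₂ (proj₂ recurrent))

        run : NonNegRun G (toppleSink κ) ord
        run = proj₂ (proj₂ (proj₂ (proj₂ recurrent)))

        ord⊆V : ord ⊆ vertices n
        ord⊆V = ∈-resp-↭ ord↭V

        V⊆ord : vertices n ⊆ ord
        V⊆ord = ∈-resp-↭ (↭-sym ord↭V)

        ord-unique : Unique ord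
        ord-unique = Unique-resp-↭ (↭⇒↭ₛ (↭-sym ord↭V)) (vertices-unique n)

        open LegalRun ord-unique ord⊆V

      κ-nonneg : ∀ {v} → v ∈ vertices n → + 0 ℤ.≤ κ v
      κ-nonneg v∈V = run-nonneg [] ord refl run (V⊆ord v∈V)

      Stuck⇒complete : ∀ {out} → out ⊆ vertices n → Stuck out → vertices n ⊆ out
      Stuck⇒complete out⊆V stuck = run-⊆ [] ord refl run out⊆V (λ ()) stuck ∘ V⊆ord

      passesOut-progress : ∀ f out → PartialWord out →
        vertices n ⊆ passesOut f out ⊎ length out + f ≤ length (passesOut f out)
      passesOut-progress zero out _ = inj₂ (≤-reflexive (+-identityʳ (length out)))
      passesOut-progress (suc f) out pw with passOut-extends out (applyDownFrom suc n) pw downFrom-⊆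
      ... | [] , fixed , _ with _ , eq , _ ← passesOut-extends f out pw
        = inj₁ (λ m → subst (_ ∈_) (sym (trans (cong (passesOut f) fixed′) eq))
                       (∈-++⁺ˡ (Stuck⇒complete (proj₂ pw) (passOut-fixed⇒Stuck fixed′) m)))
        where
        fixed′ : passOut out (applyDownFrom suc n) ≡ out
        fixed′ = trans fixed (++-identityʳ out)
      ... | e ∷ ext , eq , pw′ rewrite eq with passesOut-progress f (out ++ e ∷ ext) pw′
      ...   | inj₁ done = inj₁ done
      ...   | inj₂ grown = inj₂ (≤-trans longer grown)
        where
        longer : length out + suc f ≤ length (out ++ e ∷ ext) + f
        longer rewrite length-++ out {e ∷ ext} | +-suc (length out) f = +-monoˡ-≤ f (m<m+n (length out) (s≤s z≤n))

      all-toppled : vertices n ⊆ passesOut n []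
      all-toppled {v} v∈V with passesOut-progress n [] ([] , λ ())
      ... | inj₁ done  = done v∈V
      ... | inj₂ grown with v ∈? passesOut n []
      ...   | yes v∈σ = v∈σ
      ...   | no  v∉σ with _ , eq , (σ-unique , σ⊆V) ← passesOut-extends n [] ([] , λ ()) rewrite eq =
        ⊥-elim (<⇒≱ (length-<-⊆ σ-unique σ⊆V v∈V v∉σ) (subst (_≤ _) (sym (length-vertices n)) grown))

module Invariant where

  open import Data.Bool using (true; false; T; if_then_else_)
  open import Data.Empty using (⊥-elim)
  open import Data.Integer as ℤ using (ℤ; +_; +≤+; ∣_∣)
  import Data.Integer.Properties as ℤ
  open import Data.List using (List; []; _∷_; _++_; [_]; applyDownFrom)
  open import Data.List.Membership.Propositional using (_∈_; _∉_)
  open import Data.List.Membership.Propositional.Properties using (∈-++⁺ʳ)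
  open import Data.List.Properties using (++-assoc; ++-identityʳ)
  open import Data.List.Relation.Binary.Subset.Propositional using (_⊆_)
  open import Data.List.Relation.Unary.All as All using (All; []; _∷_)
  import Data.List.Relation.Unary.All.Properties as AllP
  open import Data.List.Relation.Unary.AllPairs using ([]; _∷_)
  open import Data.List.Relation.Unary.Any using (here; there)
  open import Data.Maybe using (just)
  open import Data.Nat using (ℕ; zero; suc; _+_; _≤_; _<_; z≤n; s≤s; _≤?_)
  open import Data.Nat.ListAction using (sum)
  open import Data.Nat.Properties
  open import Data.Product using (_×_; _,_; ∃; ∃₂; proj₁; proj₂)
  open import Data.Sum using (inj₁; inj₂)
  open import Function using (_∘_; case_of_)
  open import Relation.Binary.PropositionalEquality hiding ([_])
  open import Relation.Nullary using (¬_; yes; no)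
  open import Data.List.Membership.DecPropositional _≟_ using (_∈?_)

  open import Defs
  open ListLemmas
  open Components
  open Algorithm

  module PassInvariant (μ ν : List ℕ) (n : ℕ) (n≡ : n ≡ sum μ + sum ν) (κ : Config)
    (stable : Stable (graph μ ν n) κ) (sorted : Sorted (graph μ ν n) κ)
    (nonneg : ∀ {v} → v ∈ vertices n → + 0 ℤ.≤ κ v) where

    open Toppling μ ν n n≡ κ public

    -- Lists of toppled vertices carry the sink 0 in front, as in the word 0 σ(1) ⋯ σ(n).
    chips : ℕ → List ℕ → ℕ
    chips i L = ∣ κ i ∣ + countᵇ (adj₀ᵇ i) L

    StableAfter UnstableAfter : ℕ → List ℕ → Set
    StableAfter   i L = chips i L < deg G i
    UnstableAfter i L = deg G i ≤ chips i L

    κ≡∣κ∣ : ∀ {v} → v ∈ vertices n → κ v ≡ + ∣ κ v ∣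
    κ≡∣κ∣ {v} v∈V with κ v | nonneg v∈V
    ... | + _ | _ = refl

    configAfter-chips : ∀ {out v} → out ⊆ vertices n → v ∈ vertices n → v ∉ out → configAfter out v ≡ + chips v (0 ∷ out)
    configAfter-chips {out} {v} out⊆V v∈V v∉out =
      trans (configAfter-∉ out⊆V v∉out) (cong (ℤ._+ + countᵇ (adj₀ᵇ v) (0 ∷ out)) (κ≡∣κ∣ v∈V))

    unstableᵇ⇒ : ∀ {out v} → out ⊆ vertices n → v ∈ vertices n → v ∉ out →
      T (unstableᵇ G (configAfter out) v) → UnstableAfter v (0 ∷ out)
    unstableᵇ⇒ {v = v} out⊆V v∈V v∉out t =
      ℤ.drop‿+≤+ (subst (+ deg G v ℤ.≤_) (configAfter-chips out⊆V v∈V v∉out) (ℤ.≤ᵇ⇒≤ t))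

    ⇒unstableᵇ : ∀ {out v} → out ⊆ vertices n → v ∈ vertices n → v ∉ out →
      UnstableAfter v (0 ∷ out) → T (unstableᵇ G (configAfter out) v)
    ⇒unstableᵇ {v = v} out⊆V v∈V v∉out u =
      ℤ.≤⇒≤ᵇ (subst (+ deg G v ℤ.≤_) (sym (configAfter-chips out⊆V v∈V v∉out)) (+≤+ u))

    initially-stable : ∀ {v} → v ∈ vertices n → StableAfter v []
    initially-stable {v} v∈V with 1≤v , v≤n ← ∈-vertices⁻ v∈V =
      subst (_< deg G v) (sym (+-identityʳ _)) (ℤ.drop‿+<+ (subst (ℤ._< + deg G v) (κ≡∣κ∣ v∈V) (stable v 1≤v v≤n)))

    chips-++ : ∀ i xs ys → chips i (xs ++ ys) ≡ chips i xs + countᵇ (adj₀ᵇ i) ys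
    chips-++ i xs ys = trans (cong (λ m → ∣ κ i ∣ + m) (countᵇ-++ (adj₀ᵇ i) xs ys)) (sym (+-assoc ∣ κ i ∣ _ _))

    -- Why an untoppled unstable vertex i is unstable, while the current pass has toppled cur so far:
    -- i was stable after the prefix α of 0 ∷ out, and what was toppled since is a decreasing tail γ₁ < i
    -- of an earlier pass followed by a suffix γ₂ of cur if the scan has not reached i yet, and a suffix
    -- of cur below i if it has.  AtTopple is what is left when i topples.
    record AheadOfScan (i : ℕ) (out cur : List ℕ) : Set where
      constructor ahead
      field
        α γ₁ γ₂ δ : List ℕ
        split     : 0 ∷ out ≡ α ++ γ₁ ++ γ₂
        stable-α  : StableAfter i α
        γ₁-desc   : Decreasing γ₁
        γ₁<i      : All (_< i) γ₁
        cur≡      : cur ≡ δ ++ γ₂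

    record BehindScan (i : ℕ) (out cur : List ℕ) : Set where
      constructor behind
      field
        α γ δ    : List ℕ
        split    : 0 ∷ out ≡ α ++ γ
        stable-α : StableAfter i α
        γ<i      : All (_< i) γ
        cur≡     : cur ≡ δ ++ γ

    record AtTopple (i : ℕ) (pre : List ℕ) : Set where
      constructor at
      field
        α γ₁ γ₂   : List ℕ
        split     : 0 ∷ pre ≡ α ++ γ₁ ++ γ₂
        stable-α  : StableAfter i α
        γ₁-desc   : Decreasing γ₁
        γ₁<i      : All (_< i) γ₁
        γ₂i-desc  : Decreasing (γ₂ ++ [ i ])

    LargerSiblingsBefore : ℕ → List ℕ → Set
    LargerSiblingsBefore i pre = ∀ {k c x} → lookup i ≡ just (k , c) → T (siblingᵇ c x) → i < x → x ∈ pre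

    ToppleRecord : ℕ → List ℕ → Set
    ToppleRecord i pre = UnstableAfter i (0 ∷ pre) × LargerSiblingsBefore i pre × AtTopple i pre

    Recorded : List ℕ → Set
    Recorded out = PartialWord out × ∀ pre i post → out ≡ pre ++ i ∷ post → ToppleRecord i pre

    Witnessed : List ℕ → List ℕ → ℕ → Set
    Witnessed out cur j = ∀ {i} → i ∈ vertices n → i ∉ out → UnstableAfter i (0 ∷ out) →
      (i ≤ j → AheadOfScan i out cur) × (j < i → BehindScan i out cur)

    record PassInv (out old cur : List ℕ) (j : ℕ) : Set where
      constructor passInv
      field
        out≡     : out ≡ old ++ cur
        cur-desc : Decreasing cur
        j<cur    : All (j <_) cur
        witness  : Witnessed out cur j

    ∈-0∷ : ∀ {out y} → out ⊆ vertices n → y ∈ 0 ∷ out → y ∈ 0 ∷ vertices n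
    ∈-0∷ out⊆V (here refl) = here refl
    ∈-0∷ out⊆V (there m)   = there (out⊆V m)

    toppled≢untoppled : ∀ {out x y} → y ∈ 0 ∷ out → x ∈ vertices n → x ∉ out → y ≢ x
    toppled≢untoppled (here refl) x∈V _ refl = case proj₁ (∈-vertices⁻ x∈V) of λ ()
    toppled≢untoppled (there y∈out) _ x∉out refl = x∉out y∈out

    larger-sibling-unstable : ∀ {out J x k c} → out ⊆ vertices n → lookup J ≡ just (k , c) → T (siblingᵇ c x) → J < x →
      J ∉ out → x ∉ out → UnstableAfter J (0 ∷ out) → UnstableAfter x (0 ∷ out)
    larger-sibling-unstable {out} {J} {x} {k} {c} out⊆V eJ x-sibling J<x J∉out x∉out unstable-J = begin
      deg G x                                ≡⟨ deg-same-comp ex eJ ⟩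
      deg G J                                ≤⟨ unstable-J ⟩
      ∣ κ J ∣ + countᵇ (adj₀ᵇ J) (0 ∷ out)   ≤⟨ +-mono-≤ ∣κJ∣≤∣κx∣ (≤-reflexive same-neighbours) ⟩
      chips x (0 ∷ out)                      ∎
      where
      open ≤-Reasoning
      indep : isClique c ≡ false
      indep = proj₁ (T-siblingᵇ⇒ {c} x-sibling)

      x∈c : InComp c x
      x∈c = proj₂ (T-siblingᵇ⇒ {c} x-sibling)

      ex : lookup x ≡ just (k , c)
      ex = lookup-same eJ x∈c

      J∈V : J ∈ vertices n
      J∈V = InComp⇒∈vertices eJ (proj₂ (lookup-within eJ))

      x∈V : x ∈ vertices n
      x∈V = InComp⇒∈vertices eJ x∈c

      ∣κJ∣≤∣κx∣ : ∣ κ J ∣ ≤ ∣ κ x ∣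
      ∣κJ∣≤∣κx∣ = ℤ.drop‿+≤+ (subst₂ ℤ._≤_ (κ≡∣κ∣ J∈V) (κ≡∣κ∣ x∈V)
        (subst (λ b → if b then κ x ℤ.≤ κ J else κ J ℤ.≤ κ x) indep (sorted J x k c J<x eJ ex)))

      same-neighbours : countᵇ (adj₀ᵇ J) (0 ∷ out) ≡ countᵇ (adj₀ᵇ x) (0 ∷ out)
      same-neighbours = countᵇ-cong λ m → trans
        (adj₀ᵇ-sibling eJ (∈-0∷ out⊆V m) (toppled≢untoppled m J∈V J∉out))
        (sym (adj₀ᵇ-sibling ex (∈-0∷ out⊆V m) (toppled≢untoppled m x∈V x∉out)))

    became-unstable⇒adjacent : ∀ {i} α γ → StableAfter i α → UnstableAfter i (α ++ γ) → ∃ λ y → y ∈ γ × T (adj₀ᵇ i y)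
    became-unstable⇒adjacent {i} α γ stable unstable = countᵇ-pos (adj₀ᵇ i) γ (+-cancelˡ-< (chips i α) 0 _ (begin-strict
      chips i α + 0                          ≡⟨ +-identityʳ _ ⟩
      chips i α                              <⟨ stable ⟩
      deg G i                                ≤⟨ unstable ⟩
      chips i (α ++ γ)                       ≡⟨ chips-++ i α γ ⟩
      chips i α + countᵇ (adj₀ᵇ i) γ         ∎))
      where open ≤-Reasoning

    BehindScan⇒adjacent : ∀ {i out cur} → BehindScan i out cur → UnstableAfter i (0 ∷ out) →
      ∃ λ y → y ∈ cur × y < i × T (adj₀ᵇ i y)
    BehindScan⇒adjacent (behind α γ δ split stable-α γ<i refl) unstable
      with y , y∈γ , adjacent ← became-unstable⇒adjacent α γ stable-α (subst (UnstableAfter _) split unstable) =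
      y , ∈-++⁺ʳ δ y∈γ , All.lookup γ<i y∈γ , adjacent

    larger-siblings-before : ∀ {out old cur J} → PartialWord out → PassInv out old cur J →
      J ∉ out → UnstableAfter J (0 ∷ out) → LargerSiblingsBefore J out
    larger-siblings-before {out} {old} {cur} {J} (_ , out⊆V) (passInv out≡ _ J<cur witness) J∉out unstable-J
      {k} {c} {x} eJ x-sibling J<x with x ∈? out
    ... | yes x∈out = x∈out
    ... | no  x∉out = ⊥-elim (no-adjacent-sibling (BehindScan⇒adjacent (proj₂ (witness x∈V x∉out unstable-x) J<x) unstable-x))
      where
      x∈c : InComp c x
      x∈c = proj₂ (T-siblingᵇ⇒ {c} x-sibling)

      x∈V : x ∈ vertices n
      x∈V = InComp⇒∈vertices eJ x∈c

      unstable-x : UnstableAfter x (0 ∷ out)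
      unstable-x = larger-sibling-unstable out⊆V eJ x-sibling J<x J∉out x∉out unstable-J

      no-adjacent-sibling : ¬ (∃ λ y → y ∈ cur × y < x × T (adj₀ᵇ x y))
      no-adjacent-sibling (y , y∈cur , y<x , adjacent) =
        sibling⇒¬adj₀ᵇ (lookup-same eJ x∈c) (there (out⊆V y∈out)) (toppled≢untoppled (there y∈out) x∈V x∉out) y-sibling adjacent
        where
        y∈out : y ∈ out
        y∈out = subst (y ∈_) (sym out≡) (∈-++⁺ʳ old y∈cur)

        y-sibling : T (siblingᵇ c y)
        y-sibling = ⇒T-siblingᵇ {c} (proj₁ (T-siblingᵇ⇒ {c} x-sibling))
          (≤-trans (proj₁ (proj₂ (lookup-within eJ))) (<⇒≤ (All.lookup J<cur y∈cur)) , <-trans y<x (proj₂ x∈c))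

    private
      ++-∷ʳ : ∀ {out} α γ {J} → 0 ∷ out ≡ α ++ γ → 0 ∷ out ++ [ J ] ≡ α ++ γ ++ [ J ]
      ++-∷ʳ α γ {J} eq = trans (cong (_++ [ J ]) eq) (++-assoc α γ [ J ])

    AheadOfScan-∷ʳ : ∀ {i out cur J} → AheadOfScan i out cur → AheadOfScan i (out ++ [ J ]) (cur ++ [ J ])
    AheadOfScan-∷ʳ {J = J} (ahead α γ₁ γ₂ δ split stable-α γ₁-desc γ₁<i refl) =
      ahead α γ₁ (γ₂ ++ [ J ]) δ (trans (++-∷ʳ α (γ₁ ++ γ₂) split) (cong (α ++_) (++-assoc γ₁ γ₂ [ J ])))
        stable-α γ₁-desc γ₁<i (++-assoc δ γ₂ [ J ])

    BehindScan-∷ʳ : ∀ {i out cur J} → J < i → BehindScan i out cur → BehindScan i (out ++ [ J ]) (cur ++ [ J ])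
    BehindScan-∷ʳ {J = J} J<i (behind α γ δ split stable-α γ<i refl) =
      behind α (γ ++ [ J ]) δ (++-∷ʳ α γ split) stable-α (AllP.++⁺ γ<i (J<i ∷ [])) (++-assoc δ γ [ J ])

    fresh-ahead : ∀ {i out cur J} → StableAfter i (0 ∷ out) → AheadOfScan i (out ++ [ J ]) (cur ++ [ J ])
    fresh-ahead {out = out} {cur} {J} st = ahead (0 ∷ out) [] [ J ] cur refl st [] [] refl

    fresh-behind : ∀ {i out cur J} → J < i → StableAfter i (0 ∷ out) → BehindScan i (out ++ [ J ]) (cur ++ [ J ])
    fresh-behind {out = out} {cur} {J} J<i st = behind (0 ∷ out) [ J ] cur refl st (J<i ∷ []) refl

    AheadOfScan⇒AtTopple : ∀ {J out old cur} → PassInv out old cur J → AheadOfScan J out cur → AtTopple J out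
    AheadOfScan⇒AtTopple (passInv _ cur-desc J<cur _) (ahead α γ₁ γ₂ δ split stable-α γ₁-desc γ₁<J refl) =
      at α γ₁ γ₂ split stable-α γ₁-desc γ₁<J
        (AllPairs-∷ʳ (AllPairs-++⁻ʳ δ cur-desc) (AllP.++⁻ʳ δ J<cur))

    Recorded-∷ʳ : ∀ {out J} → Recorded out → J ∈ vertices n → J ∉ out → ToppleRecord J out → Recorded (out ++ [ J ])
    Recorded-∷ʳ {out} {J} ((u , out⊆V) , records) J∈V J∉out record-J =
      (Unique-∷ʳ out u J∉out , ∷ʳ-⊆ out out⊆V J∈V) , λ pre i post eq → case ∷ʳ-split out pre post eq of λ
        { (inj₁ (refl , refl)) → record-J
        ; (inj₂ (post′ , eq′)) → records pre i post′ eq′ }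

    Witnessed-∷ʳ : ∀ {out old cur j} → PassInv out old cur (suc j) → suc j ∉ out →
      Witnessed (out ++ [ suc j ]) (cur ++ [ suc j ]) j
    Witnessed-∷ʳ {out} {cur = cur} {j} (passInv _ _ _ witness) J∉out {i} i∈V i∉out∷ʳJ _
      with i∉out , i≢J ← ∉-∷ʳ⁻ out i∉out∷ʳJ | deg G i ≤? chips i (0 ∷ out)
    ... | yes unstable =
      (λ i≤j → AheadOfScan-∷ʳ (proj₁ old (m≤n⇒m≤1+n i≤j))) , (λ j<i → BehindScan-∷ʳ (J<i j<i) (proj₂ old (J<i j<i)))
      where
      old : (i ≤ suc j → AheadOfScan i out cur) × (suc j < i → BehindScan i out cur)
      old = witness i∈V i∉out unstable

      J<i : j < i → suc j < i
      J<i j<i = ≤∧≢⇒< j<i (i≢J ∘ sym)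
    ... | no  stable = (λ _ → fresh-ahead (≰⇒> stable)) , (λ j<i → fresh-behind (≤∧≢⇒< j<i (i≢J ∘ sym)) (≰⇒> stable))

    topple-step : ∀ {out old cur j} → Recorded out → PassInv out old cur (suc j) → suc j ∈ vertices n →
      T (topplesᵇ out (suc j)) → Recorded (out ++ [ suc j ]) × PassInv (out ++ [ suc j ]) old (cur ++ [ suc j ]) j
    topple-step {out} {old} {cur} {j} rec@((_ , out⊆V) , _) inv@(passInv out≡ cur-desc J<cur witness) J∈V t =
      Recorded-∷ʳ rec J∈V J∉out (unstable-J , larger-siblings-before (proj₁ rec) inv J∉out unstable-J , at-J) ,
      passInv (trans (cong (_++ [ suc j ]) out≡) (++-assoc old cur [ suc j ]))
              (AllPairs-∷ʳ cur-desc J<cur)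
              (AllP.++⁺ (All.map (λ J<y → <-trans (n<1+n j) J<y) J<cur) (n<1+n j ∷ []))
              (Witnessed-∷ʳ inv J∉out)
      where
      J∉out : suc j ∉ out
      J∉out = proj₁ (topplesᵇ⇒ {out} t)

      unstable-J : UnstableAfter (suc j) (0 ∷ out)
      unstable-J = unstableᵇ⇒ out⊆V J∈V J∉out (proj₂ (topplesᵇ⇒ {out} t))

      at-J : AtTopple (suc j) out
      at-J = AheadOfScan⇒AtTopple inv (proj₁ (witness J∈V J∉out unstable-J) ≤-refl)

    skip-step : ∀ {out old cur j} → PartialWord out → PassInv out old cur (suc j) →
      ¬ T (topplesᵇ out (suc j)) → PassInv out old cur j
    skip-step {out} {j = j} (_ , out⊆V) (passInv out≡ cur-desc J<cur witness) ¬t =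
      passInv out≡ cur-desc (All.map (λ J<y → <-trans (n<1+n j) J<y) J<cur) λ {i} i∈V i∉out unstable →
        (λ i≤j → proj₁ (witness i∈V i∉out unstable) (m≤n⇒m≤1+n i≤j)) ,
        (λ j<i → case i ≟ suc j of λ
          { (yes refl) → ⊥-elim (¬topplesᵇ⇒ ¬t i∉out (⇒unstableᵇ out⊆V i∈V i∉out unstable))
          ; (no i≢J) → proj₂ (witness i∈V i∉out unstable) (≤∧≢⇒< j<i (i≢J ∘ sym)) })

    restart : ∀ {out old cur} → PassInv out old cur 0 → PassInv out out [] n
    restart {out} (passInv out≡ cur-desc _ witness) = passInv (sym (++-identityʳ out)) [] [] λ i∈V i∉out unstable →
      (λ _ → ahead-from (proj₂ (witness i∈V i∉out unstable) (proj₁ (∈-vertices⁻ i∈V)))) ,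
      (λ n<i → ⊥-elim (<⇒≱ n<i (proj₂ (∈-vertices⁻ i∈V))))
      where
      ahead-from : ∀ {i} → BehindScan i out _ → AheadOfScan i out []
      ahead-from (behind α γ δ split stable-α γ<i refl) =
        ahead α γ [] [] (trans split (cong (α ++_) (sym (++-identityʳ γ)))) stable-α (AllPairs-++⁻ʳ δ cur-desc) γ<i refl

    initial : PassInv [] [] [] n
    initial = passInv refl [] [] λ i∈V _ _ →
      (λ _ → ahead [] [ 0 ] [] [] refl (initially-stable i∈V) ([] ∷ []) (proj₁ (∈-vertices⁻ i∈V) ∷ []) refl) ,
      (λ n<i → ⊥-elim (<⇒≱ n<i (proj₂ (∈-vertices⁻ i∈V))))

    pass-preserves : ∀ j → j ≤ n → ∀ {out old cur} → Recorded out → PassInv out old cur j →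
      ∃₂ λ old′ cur′ → Recorded (passOut out (applyDownFrom suc j)) × PassInv (passOut out (applyDownFrom suc j)) old′ cur′ 0
    pass-preserves zero    _   rec inv = _ , _ , rec , inv
    pass-preserves (suc j) 1+j≤n {out} rec inv with topplesᵇ out (suc j) in t
    ... | true  with rec′ , inv′ ← topple-step rec inv (∈-vertices⁺ (s≤s z≤n) 1+j≤n) (subst T (sym t) _)
      = pass-preserves j (<⇒≤ 1+j≤n) rec′ inv′
    ... | false = pass-preserves j (<⇒≤ 1+j≤n) rec (skip-step (proj₁ rec) inv (subst T t))

    passes-preserve : ∀ f {out} → Recorded out → PassInv out out [] n → Recorded (passesOut f out)
    passes-preserve zero    rec _   = rec
    passes-preserve (suc f) rec inv with _ , _ , rec′ , inv′ ← pass-preserves n ≤-refl rec inv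
      = passes-preserve f rec′ (restart inv′)

    output-recorded : Recorded (passesOut n [])
    output-recorded = passes-preserve n (([] , λ ()) , λ { [] _ _ () ; (_ ∷ _) _ _ () }) initial

module Bounds where

  open import Data.Bool using (true; false; not; T; if_then_else_)
  open import Data.Empty using (⊥-elim)
  open import Data.Integer as ℤ using (ℤ; +_; +≤+; +<+; ∣_∣)
  import Data.Integer.Properties as ℤ
  open import Data.List using (List; []; _∷_; _++_; [_]; length)
  open import Data.List.Membership.Propositional using (_∈_; _∉_)
  open import Data.List.Membership.Propositional.Properties using (∈-++⁺ˡ; ∈-++⁺ʳ; ∈-∃++)
  open import Data.List.Properties using (++-assoc; length-++)
  open import Data.List.Relation.Binary.Subset.Propositional using (_⊆_)
  open import Data.List.Relation.Unary.All as All using (All)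
  open import Data.List.Relation.Unary.AllPairs using (_∷_)
  open import Data.List.Relation.Unary.Any using (here; there)
  open import Data.List.Relation.Unary.Unique.Propositional using (Unique)
  open import Data.Maybe using (just)
  open import Data.Nat using (ℕ; suc; _+_; _∸_; _≤_; _<_; z≤n; s≤s)
  open import Data.Nat.ListAction using (sum)
  open import Data.Nat.Properties
  open import Data.Nat.Tactic.RingSolver using (solve-∀)
  open import Data.Product using (_×_; _,_; proj₁; proj₂)
  open import Function using (_∘_; case_of_)
  open import Relation.Binary.Definitions using (tri<; tri≈; tri>)
  open import Relation.Binary.PropositionalEquality hiding ([_])

  open import Defs
  open ListLemmas
  open Components
  open Algorithm
  open Invariant
  open Runs

  n≤m<n+w⇒0≤m-n<w : ∀ {n m w} → n ≤ m → m < n + w → + 0 ℤ.≤ + m ℤ.- + n × + m ℤ.- + n ℤ.< + w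
  n≤m<n+w⇒0≤m-n<w {n} {m} {w} n≤m m<n+w rewrite ℤ.[+m]-[+n]≡m⊖n m n | ℤ.⊖-≥ n≤m =
    +≤+ z≤n , +<+ (+-cancelˡ-< n (m ∸ n) w (subst (_< n + w) (sym (m+[n∸m]≡n n≤m)) m<n+w))

  private
    lower-shuffle : ∀ k a e s → k + a + (e + suc s) ≡ suc (a + s + (k + e))
    lower-shuffle = solve-∀

    upper-shuffle : ∀ a b l k e x → a + b + l + (k + e) + suc x ≡ k + a + (b + (l + (e + suc x)))
    upper-shuffle = solve-∀

    upper-shuffle′ : ∀ d x l e → d + (x + (l + (e + suc x))) ≡ d + (e + suc x) + (l + x)
    upper-shuffle′ = solve-∀

    upper-shuffle″ : ∀ n l x → suc n + (l + x) ≡ n + l + suc x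
    upper-shuffle″ = solve-∀

  -- i has M non-neighbours counting itself, A of them above i, and κ̃(i) = k + e; the word 0 ∷ pre of
  -- length P contains adjPre neighbours and sibPre non-neighbours of i, its prefix α of length a
  -- contains adjα and sibα, and L ≤ w letters follow α.
  position-bounds : ∀ {n deg M e A k P adjPre sibPre a adjα sibα L w} →
    deg + M ≡ suc n → e + suc A ≡ M →
    deg ≤ k + adjPre → adjPre + sibPre ≡ P → A ≤ sibPre →
    k + adjα < deg → adjα + sibα ≡ a → sibα ≤ A → P ≡ a + L → L ≤ w →
    n ≤ P + (k + e) × P + (k + e) < n + w
  position-bounds {n} {deg} {M} {e} {A} {k} {P} {adjPre} {sibPre} {a} {adjα} {sibα} {L} {w}
    deg+M e+A unstable pre-split A≤sibPre stable α-split sibα≤A P≡ L≤w = lower , upper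
    where
    lower : n ≤ P + (k + e)
    lower = ≤-pred (begin
      suc n                              ≡⟨ sym deg+M ⟩
      deg + M                            ≡⟨ cong (λ m → deg + m) (sym e+A) ⟩
      deg + (e + suc A)                  ≤⟨ +-mono-≤ unstable (+-monoʳ-≤ e (s≤s A≤sibPre)) ⟩
      k + adjPre + (e + suc sibPre)      ≡⟨ lower-shuffle k adjPre e sibPre ⟩
      suc (adjPre + sibPre + (k + e))    ≡⟨ cong (λ p → suc (p + (k + e))) pre-split ⟩
      suc (P + (k + e))                  ∎)
      where open ≤-Reasoning

    upper : P + (k + e) < n + w
    upper = +-cancelʳ-< (suc A) _ _ (begin-strict
      P + (k + e) + suc A                          ≡⟨ cong (λ p → p + (k + e) + suc A) (trans P≡ (cong (_+ L) (sym α-split))) ⟩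
      adjα + sibα + L + (k + e) + suc A            ≡⟨ upper-shuffle adjα sibα L k e A ⟩
      k + adjα + (sibα + (L + (e + suc A)))        <⟨ +-monoˡ-< _ stable ⟩
      deg + (sibα + (L + (e + suc A)))             ≤⟨ +-monoʳ-≤ deg (+-monoˡ-≤ _ sibα≤A) ⟩
      deg + (A + (L + (e + suc A)))                ≡⟨ upper-shuffle′ deg A L e ⟩
      deg + (e + suc A) + (L + A)                  ≡⟨ cong (λ m → deg + m + (L + A)) e+A ⟩
      deg + M + (L + A)                            ≡⟨ cong (_+ (L + A)) deg+M ⟩
      suc n + (L + A)                              ≡⟨ upper-shuffle″ n L A ⟩
      n + L + suc A                                ≤⟨ +-monoˡ-≤ (suc A) (+-monoʳ-≤ n L≤w) ⟩
      n + w + suc A                                ∎)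
      where open ≤-Reasoning

  module _ (μ ν : List ℕ) (n : ℕ) (n≡ : n ≡ sum μ + sum ν) (κ : Config) where

    open Vertices μ ν n n≡

    -- For a clique vertex excess, above and nonAdj are 0, 0 and 1; for a vertex i of an independent
    -- component I they are κ̃(i) − κ(i), the number of vertices of I above i, and |I|.
    record Profile (i : ℕ) (c : Comp) : Set where
      field
        excess above nonAdj : ℕ
        κtilde≡             : κtilde G κ i ≡ κ i ℤ.+ + excess
        excess+above        : excess + suc above ≡ nonAdj
        countᵇ-nonAdjᵇ≡     : countᵇ (nonAdjᵇ c i) (vertices n) ≡ nonAdj
        above⇒sibling       : ∀ {x} → x ∈ range (suc i) above → T (siblingᵇ c x)
        sibling⇒above       : ∀ {x} → T (siblingᵇ c x) → i < x → x ∈ range (suc i) above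

    κtilde-lookup : ∀ {i k c} → lookup i ≡ just (k , c) →
      κtilde G κ i ≡ (if isClique c then κ i else κ i ℤ.+ + (size c ∸ (lo c + size c ∸ i)))
    κtilde-lookup ei rewrite ei = refl

    profile : ∀ {i k c} → lookup i ≡ just (k , c) → Profile i c
    profile {i} {k} {c} ei with isClique c in cl
    ... | true = record
      { excess = 0 ; above = 0 ; nonAdj = 1
      ; κtilde≡ = trans (κtilde-lookup ei) (trans (cong (λ b → if b then κ i else _) cl) (sym (ℤ.+-identityʳ (κ i))))
      ; excess+above = refl
      ; countᵇ-nonAdjᵇ≡ = countᵇ-nonAdjᵇ-clique ei cl
      ; above⇒sibling = λ ()
      ; sibling⇒above = λ sib _ → case trans (sym cl) (proj₁ (T-siblingᵇ⇒ {c} sib)) of λ ()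
      }
    ... | false = record
      { excess = excess ; above = above ; nonAdj = size c
      ; κtilde≡ = trans (κtilde-lookup ei) (cong (λ b → if b then κ i else κ i ℤ.+ + excess) cl)
      ; excess+above = excess+above
      ; countᵇ-nonAdjᵇ≡ = countᵇ-nonAdjᵇ-indep ei cl
      ; above⇒sibling = λ {x} m → let (i<x , x<) = ∈-range⁻ m in
          ⇒T-siblingᵇ {c} cl (≤-trans lo≤i (<⇒≤ i<x) , subst (x <_) top≡ x<)
      ; sibling⇒above = λ {x} sib i<x → ∈-range⁺ i<x (subst (x <_) (sym top≡) (proj₂ (proj₂ (T-siblingᵇ⇒ {c} sib))))
      }
      where
      excess = size c ∸ (lo c + size c ∸ i)
      above = lo c + size c ∸ suc i
      lo≤i : lo c ≤ i
      lo≤i = proj₁ (proj₂ (lookup-within ei))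

      i<top : i < lo c + size c
      i<top = proj₂ (proj₂ (lookup-within ei))

      top≡ : suc i + above ≡ lo c + size c
      top≡ = m+[n∸m]≡n i<top
      excess+above : excess + suc above ≡ size c
      excess+above = begin
        size c ∸ (lo c + size c ∸ i) + suc above  ≡⟨ cong (λ m → size c ∸ m + suc above) top∸i ⟩
        size c ∸ suc above + suc above            ≡⟨ m∸n+n≡m (subst (_≤ size c) top∸i (∸-top-≤)) ⟩
        size c                                    ∎
        where
        open ≡-Reasoning
        top∸i : lo c + size c ∸ i ≡ suc above
        top∸i = trans (cong (_∸ i) (trans (sym top≡) (sym (+-suc i above)))) (m+n∸m≡n i (suc above))
        ∸-top-≤ : lo c + size c ∸ i ≤ size c
        ∸-top-≤ = ≤-trans (∸-monoʳ-≤ (lo c + size c) lo≤i) (≤-reflexive (m+n∸m≡n (lo c) (size c)))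

  module _ (μ ν : List ℕ) (n : ℕ) (n≡ : n ≡ sum μ + sum ν) (κ : Config)
    (sorted : Sorted (graph μ ν n) κ) (recurrent : Recurrent (graph μ ν n) κ) where

    open PassInvariant μ ν n n≡ κ (proj₁ recurrent) sorted (Toppling.κ-nonneg μ ν n n≡ κ recurrent)

    σ : List ℕ
    σ = passesOut n []

    module AtVertex {i k c} pre post (σ≡ : σ ≡ pre ++ i ∷ post) (ei : lookup i ≡ just (k , c)) where

      open Profile (profile μ ν n n≡ κ ei)

      σ-unique : Unique σ
      σ-unique = proj₁ (proj₁ output-recorded)

      σ⊆V : σ ⊆ vertices n
      σ⊆V = proj₂ (proj₁ output-recorded)

      record-of : ∀ pre′ {x} post′ → σ ≡ pre′ ++ x ∷ post′ → ToppleRecord x pre′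
      record-of pre′ post′ = proj₂ output-recorded pre′ _ post′

      pre⊆V : pre ⊆ vertices n
      pre⊆V m = σ⊆V (subst (_ ∈_) (sym σ≡) (∈-++⁺ˡ m))

      i∉pre : i ∉ pre
      i∉pre = Unique-++-∷⇒∉ pre (subst Unique σ≡ σ-unique)

      i∈V : i ∈ vertices n
      i∈V = σ⊆V (subst (i ∈_) (sym σ≡) (∈-++⁺ʳ pre (here refl)))

      0∷pre-unique : Unique (0 ∷ pre)
      0∷pre-unique = All.tabulate (λ m → λ { refl → case proj₁ (∈-vertices⁻ (pre⊆V m)) of λ () })
                     ∷ Unique-++⁻ˡ pre (subst Unique σ≡ σ-unique)

      open AtTopple (proj₂ (proj₂ (record-of pre post σ≡)))

      0∷pre-vertex : ∀ {x} → x ∈ 0 ∷ pre → x ∈ 0 ∷ vertices n × x ≢ i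
      0∷pre-vertex (here refl) = here refl , λ { refl → case proj₁ (∈-vertices⁻ i∈V) of λ () }
      0∷pre-vertex (there m)   = there (pre⊆V m) , λ { refl → i∉pre m }

      α⊆0∷pre : ∀ {x} → x ∈ α → x ∈ 0 ∷ pre
      α⊆0∷pre m = subst (_ ∈_) (sym split) (∈-++⁺ˡ m)

      adj₀-+-sibling : ∀ {X} → (∀ {x} → x ∈ X → x ∈ 0 ∷ pre) → countᵇ (adj₀ᵇ i) X + countᵇ (siblingᵇ c) X ≡ length X
      adj₀-+-sibling {X} X⊆ = begin
        countᵇ (adj₀ᵇ i) X + countᵇ (siblingᵇ c) X          ≡⟨ cong (_+ countᵇ (siblingᵇ c) X) (countᵇ-cong adj≡) ⟩
        countᵇ (not ∘ siblingᵇ c) X + countᵇ (siblingᵇ c) X ≡⟨ +-comm (countᵇ (not ∘ siblingᵇ c) X) _ ⟩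
        countᵇ (siblingᵇ c) X + countᵇ (not ∘ siblingᵇ c) X ≡⟨ countᵇ-+-not (siblingᵇ c) X ⟩
        length X                                            ∎
        where
        open ≡-Reasoning
        adj≡ : ∀ {x} → x ∈ X → adj₀ᵇ i x ≡ not (siblingᵇ c x)
        adj≡ m = let (x∈0V , x≢i) = 0∷pre-vertex (X⊆ m) in adj₀ᵇ-sibling ei x∈0V x≢i

      larger-siblings-toppled : above ≤ countᵇ (siblingᵇ c) (0 ∷ pre)
      larger-siblings-toppled = subst (_≤ _) (length-range (suc i) above) (length-≤-countᵇ-⊆ (range-unique (suc i) above) λ m →
        there (proj₁ (proj₂ (record-of pre post σ≡)) ei (above⇒sibling m) (proj₁ (∈-range⁻ m))) , above⇒sibling m)

      toppled-siblings-larger : ∀ {x} → x ∈ 0 ∷ pre → T (siblingᵇ c x) → i < x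
      toppled-siblings-larger (here refl) sib with (1≤lo , _) , _ ← lookup-within ei | (lo≤0 , _) ← proj₂ (T-siblingᵇ⇒ {c} sib)
        = ⊥-elim (case ≤-trans 1≤lo lo≤0 of λ ())
      toppled-siblings-larger {x} (there x∈pre) sib with ∈-∃++ x∈pre
      ... | p₁ , p₂ , refl with <-cmp x i
      ... | tri< x<i _ _ = ⊥-elim (i∉pre (∈-++⁺ˡ (larger-before-x (lookup-same ei x∈c) (⇒T-siblingᵇ {c} indep i∈c) x<i)))
        where
        indep : isClique c ≡ false
        indep = proj₁ (T-siblingᵇ⇒ {c} sib)

        x∈c : InComp c x
        x∈c = proj₂ (T-siblingᵇ⇒ {c} sib)

        i∈c : InComp c i
        i∈c = proj₂ (lookup-within ei)

        larger-before-x : LargerSiblingsBefore x p₁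
        larger-before-x = proj₁ (proj₂ (record-of p₁ (p₂ ++ i ∷ post) (trans σ≡ (++-assoc p₁ (x ∷ p₂) (i ∷ post)))))
      ... | tri≈ _ refl _ = ⊥-elim (i∉pre x∈pre)
      ... | tri> _ _ i<x = i<x

      α-siblings-larger : countᵇ (siblingᵇ c) α ≤ above
      α-siblings-larger = subst (_ ≤_) (length-range (suc i) above)
        (countᵇ-≤-length-⊆ (Unique-++⁻ˡ α (subst Unique split 0∷pre-unique)) λ m sib →
          sibling⇒above sib (toppled-siblings-larger (α⊆0∷pre m) sib))

      0∷σ≡ : 0 ∷ σ ≡ α ++ γ₁ ++ γ₂ ++ i ∷ post
      0∷σ≡ = trans (cong (0 ∷_) σ≡) (trans (cong (_++ i ∷ post) split)
               (trans (++-assoc α (γ₁ ++ γ₂) (i ∷ post)) (cong (α ++_) (++-assoc γ₁ γ₂ (i ∷ post)))))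

      tail≤w : length γ₁ + length γ₂ ≤ wStat σ i
      tail≤w = subst (λ w → length γ₁ + length γ₂ ≤ wFrom i [] (runsW w)) (sym 0∷σ≡)
        (w-bound i α γ₁ γ₂ post i∉αγ γ₁-desc γ₁<i γ₂i-desc)
        where
        i∉αγ : i ∉ α ++ γ₁ ++ γ₂
        i∉αγ m = proj₂ (0∷pre-vertex (subst (i ∈_) (sym split) m)) refl

      position≡ : position σ i ≡ length (0 ∷ pre)
      position≡ = trans (cong (λ w → position w i) σ≡) (position-++-∷ pre post i∉pre)

      length-split : length (0 ∷ pre) ≡ length α + (length γ₁ + length γ₂)
      length-split = trans (cong length split) (trans (length-++ α) (cong (λ m → length α + m) (length-++ γ₁)))

      uStat-bounds : + 0 ℤ.≤ uStat G κ σ i × uStat G κ σ i ℤ.< + wStat σ i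
      uStat-bounds = subst (λ u → + 0 ℤ.≤ u × u ℤ.< + wStat σ i) (sym uStat≡)
        (n≤m<n+w⇒0≤m-n<w (proj₁ bounds) (proj₂ bounds))
        where
        bounds : n ≤ length (0 ∷ pre) + (∣ κ i ∣ + excess) × length (0 ∷ pre) + (∣ κ i ∣ + excess) < n + wStat σ i
        bounds = position-bounds
          (trans (cong (λ m → deg G i + m) (sym countᵇ-nonAdjᵇ≡)) (deg-+-nonAdj ei)) excess+above
          (proj₁ (record-of pre post σ≡)) (adj₀-+-sibling (λ m → m)) larger-siblings-toppled
          stable-α (adj₀-+-sibling α⊆0∷pre) α-siblings-larger length-split tail≤w
        uStat≡ : uStat G κ σ i ≡ + (length (0 ∷ pre) + (∣ κ i ∣ + excess)) ℤ.- + n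
        uStat≡ = cong₂ (λ p t → (+ p ℤ.+ t) ℤ.- + n) position≡ (trans κtilde≡ (cong (ℤ._+ + excess) (κ≡∣κ∣ i∈V)))

    output-bounds : ∀ {i} → i ∈ vertices n → + 0 ℤ.≤ uStat G κ σ i × uStat G κ σ i ℤ.< + wStat σ i
    output-bounds i∈V with pre , post , σ≡ ← ∈-∃++ (all-toppled recurrent i∈V) | _ , _ , ei ← lookup-total i∈V
      = AtVertex.uStat-bounds pre post σ≡ ei

open import Defs
open import Data.Nat using (ℕ; _≤_; _+_)
open import Data.Integer using (+_; _<_) renaming (_≤_ to _≤ℤ_)
open import Data.List using (List)
open import Data.Nat.ListAction using (sum)
open import Data.Product using (_×_)
open import Relation.Binary.PropositionalEquality using (_≡_; subst; sym; trans)
open Components using (∈-vertices⁺)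
open Algorithm using (module Toppling)
open Bounds using (output-bounds)

proposition6p6 : (μ ν : List ℕ) → IsComposition μ → IsComposition ν →
    (n : ℕ) → n ≡ sum μ + sum ν →
    (κ : Config) → Sorted (graph μ ν n) κ → Recurrent (graph μ ν n) κ →
    (σ : List ℕ) → σ ≡ outputWord (graph μ ν n) κ →
    (i : ℕ) → 1 ≤ i → i ≤ n →
    (+ 0 ≤ℤ uStat (graph μ ν n) κ σ i) × (uStat (graph μ ν n) κ σ i < + wStat σ i)
-- The parts of μ and ν need not be positive: an empty component has no vertices.
proposition6p6 μ ν _ _ n n≡ κ sorted recurrent σ σ≡ i 1≤i i≤n =
  subst (λ s → (+ 0 ≤ℤ uStat (graph μ ν n) κ s i) × (uStat (graph μ ν n) κ s i < + wStat s i))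
    (sym (trans σ≡ (Toppling.outputWord≡passesOut μ ν n n≡ κ)))
    (output-bounds μ ν n n≡ κ sorted recurrent (∈-vertices⁺ 1≤i i≤n))
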